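{- Let $2\le n\le\omega$ and let $M$ be the generic $n$-partite tournament. (i) If $2<n<\omega$, then $M$ has no local SWIR, but $M$ has a finite SIR expansion. (ii) If $n=2$, then $M$ has a local SWIR but no (global) SWIR. (iii) If $n=\omega$, then $M$ has a (global) SWIR.
   Context: For an oriented graph $A$ and distinct $x,y\in A$, write $x\perp y$ if there is no directed edge between $x$ and $y$. $A$ is an $n$-partite tournament if $\perp$ (together with equality) is an equivalence relation with at most $n$ equivalence classes (parts). The class of finite $n$-partite tournaments is a Fraïssé class; its Fraïssé limit is the generic $n$-partite tournament. A SWIR on a Fraïssé (countable ultrahomogeneous) structure $M$ is a ternary relation $B\mathop{\smile\!\!\!\!\!\!|}_A C$ on finite substructures (base possibly empty) satisfying, with $AB$ the substructure on $A\cup B$: Invariance under $\mathrm{Aut}(M)$; Existence (for all $A,B,C$ there is $g\in\mathrm{Aut}(M)$ fixing $A$ pointwise with $gB\mathop{\smile\!\!\!\!\!\!|}_A C$, and $h$ fixing $A$ pointwise with $B\mathop{\smile\!\!\!\!\!\!|}_A hC$); Stationarity (if $B\mathop{\smile\!\!\!\!\!\!|}_A C$, $B'\mathop{\smile\!\!\!\!\!\!|}_A C$ and an automorphism fixing $A$ pointwise restricts to $\sigma:B\to B'$, then an automorphism fixing $AC$ pointwise restricts to $\sigma$; and the symmetric right version); Monotonicity ($BD\mathop{\smile\!\!\!\!\!\!|}_A C\Rightarrow B\mathop{\smile\!\!\!\!\!\!|}_A C\wedge D\mathop{\smile\!\!\!\!\!\!|}_{AB}C$; $B\mathop{\smile\!\!\!\!\!\!|}_A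 CD\Rightarrow B\mathop{\smile\!\!\!\!\!\!|}_A C\wedge B\mathop{\smile\!\!\!\!\!\!|}_{AC}D$). A local SWIR is defined only for non-empty bases and satisfies the same axioms. A (local) SIR is a symmetric (local) SWIR: $B\mathop{\smile\!\!\!\!\!\!|}_A C\iff C\mathop{\smile\!\!\!\!\!\!|}_A B$. A finite SIR expansion of $M$ is an ultrahomogeneous expansion of $M$ in a finite language that has a SIR. -}

module Defs where

open import Data.Nat using (ℕ; zero; suc)
open import Data.Bool using (Bool; true; false)
open import Data.Fin using (Fin) renaming (zero to fzero; suc to fsuc)
open import Data.Vec using (Vec; []; _∷_; lookup)
import Data.Vec as V
open import Data.List using (List; []; _++_; length)
import Data.List as L
open import Data.List.Membership.Propositional using (_∈_)
open import Data.Product using (Σ; _×_; _,_; ∃; proj₁)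
open import Data.Sum using (_⊎_)
open import Data.Unit using (⊤)
open import Level using (Level)
open import Relation.Nullary using (¬_)
open import Relation.Binary.PropositionalEquality using (_≡_; _≢_)
open import Relation.Binary.Structures using (IsEquivalence)
open import Function.Bundles using (_↔_; Inverse)

data Card : Set where
  fin : ℕ → Card
  ω   : Card

-- n-partite tournaments (on an arbitrary carrier X, edges given by a
-- Boolean-valued directed-edge relation e : e x y ≡ true means x → y).

module _ {X : Set} (e : X → X → Bool) where

  IsOriented : Set
  IsOriented = (∀ x → e x x ≡ false) × (∀ x y → e x y ≡ true → e y x ≡ false)

  Perp : X → X → Set
  Perp x y = x ≢ y × e x y ≡ false × e y x ≡ false

  PerpOrEq : X → X → Set
  PerpOrEq x y = x ≡ y ⊎ Perp x y

  -- "at most n equivalence classes": the classes inject into Fin n,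
  -- i.e. there is a class-labelling x ↦ c x with x ~ y ⇔ c x ≡ c y.
  AtMostClasses : Card → Set
  AtMostClasses (fin n) = Σ (X → Fin n) λ c →
    ∀ x y → (PerpOrEq x y → c x ≡ c y) × (c x ≡ c y → PerpOrEq x y)
  AtMostClasses ω = ⊤   -- at most ω (countably many) classes: automatic here

  IsPartiteTournament : Card → Set
  IsPartiteTournament n =
    IsOriented × IsEquivalence PerpOrEq × AtMostClasses n

Distinct : ∀ {k} → Vec ℕ k → Set
Distinct {k} xs = ∀ (i j : Fin k) → lookup xs i ≡ lookup xs j → i ≡ j

-- induced substructure on (an enumeration without repetition of) a finite set
induced : ∀ {k} → (ℕ → ℕ → Bool) → Vec ℕ k → Fin k → Fin k → Bool
induced E xs i j = E (lookup xs i) (lookup xs j)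

AgeIn : Card → (ℕ → ℕ → Bool) → Set
AgeIn n E = ∀ k (xs : Vec ℕ k) → Distinct xs →
  IsPartiteTournament (induced E xs) n

AllEmbed : Card → (ℕ → ℕ → Bool) → Set
AllEmbed n E = ∀ k (e : Fin k → Fin k → Bool) → IsPartiteTournament e n →
  Σ (Vec ℕ k) λ xs → Distinct xs × (∀ i j → E (lookup xs i) (lookup xs j) ≡ e i j)

-- Countable relational structures on ℕ in a finite relational language.
-- A language is a list of arities; a structure interprets symbol r of
-- arity m as a Boolean predicate on m-tuples.

record Structure (ar : List ℕ) : Set where
  constructor mkStr
  field
    rel : (r : Fin (length ar)) → Vec ℕ (L.lookup ar r) → Bool
open Structure public

IsAut : ∀ {ar} → Structure ar → ℕ ↔ ℕ → Set
IsAut {ar} S g = ∀ (r : Fin (length ar)) (v : Vec ℕ (L.lookup ar r)) →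
  rel S r (V.map (Inverse.to g) v) ≡ rel S r v

Aut : ∀ {ar} → Structure ar → Set
Aut S = Σ (ℕ ↔ ℕ) (IsAut S)

PartialIso : ∀ {ar k} → Structure ar → Vec ℕ k → Vec ℕ k → Set
PartialIso {ar} {k} S xs ys =
  (∀ i j → lookup xs i ≡ lookup xs j → lookup ys i ≡ lookup ys j) ×
  (∀ i j → lookup ys i ≡ lookup ys j → lookup xs i ≡ lookup xs j) ×
  (∀ (r : Fin (length ar)) (t : Vec (Fin k) (L.lookup ar r)) →
     rel S r (V.map (lookup xs) t) ≡ rel S r (V.map (lookup ys) t))

Ultrahomogeneous : ∀ {ar} → Structure ar → Set
Ultrahomogeneous S = ∀ k (xs ys : Vec ℕ k) → PartialIso S xs ys →
  Σ (Aut S) λ g → ∀ i → Inverse.to (proj₁ g) (lookup xs i) ≡ lookup ys i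

graphRel : (ℕ → ℕ → Bool) → (r : Fin 1) → Vec ℕ (L.lookup (2 L.∷ L.[]) r) → Bool
graphRel E fzero (x ∷ y ∷ []) = E x y

graphStr : (ℕ → ℕ → Bool) → Structure (2 L.∷ L.[])
graphStr E = mkStr (graphRel E)

expandRel : (ℕ → ℕ → Bool) → (ar : List ℕ) → Structure ar →
  (r : Fin (suc (length ar))) → Vec ℕ (L.lookup (2 L.∷ ar) r) → Bool
expandRel E ar S fzero (x ∷ y ∷ []) = E x y
expandRel E ar S (fsuc r) v = rel S r v

expand : (ℕ → ℕ → Bool) → (ar : List ℕ) → Structure ar → Structure (2 L.∷ ar)
expand E ar S = mkStr (expandRel E ar S)

-- The generic n-partite tournament (Fraïssé limit of the class K_n of
-- finite n-partite tournaments): a countable structure (on ℕ) whose age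
-- is exactly K_n and which is ultrahomogeneous.

IsGenericPartiteTournament : Card → (ℕ → ℕ → Bool) → Set
IsGenericPartiteTournament n E =
  AgeIn n E × AllEmbed n E × Ultrahomogeneous (graphStr E)

-- Independence relations. Finite substructures are represented by
-- finite lists of elements (substructure = induced on the underlying set).
-- Ind A B C  means  B ⫝_A C.

IndRel : Set₁
IndRel = List ℕ → List ℕ → List ℕ → Set

_≈ₛ_ : List ℕ → List ℕ → Set
xs ≈ₛ ys = ∀ x → (x ∈ xs → x ∈ ys) × (x ∈ ys → x ∈ xs)

Fixes : ℕ ↔ ℕ → List ℕ → Set
Fixes g A = ∀ a → a ∈ A → Inverse.to g a ≡ a

image : ℕ ↔ ℕ → List ℕ → List ℕ
image g = L.map (Inverse.to g)

-- The axioms, with the admissible bases restricted by a predicate Base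
-- (Base = everything for a SWIR; Base = non-empty for a local SWIR).
module _ {ar : List ℕ} (S : Structure ar) (Base : List ℕ → Set) (Ind : IndRel) where

  -- the relation is a relation on finite substructures (sets)
  Extensional : Set
  Extensional = ∀ A A' B B' C C' → Base A → A ≈ₛ A' → B ≈ₛ B' → C ≈ₛ C' →
    Ind A B C → Ind A' B' C'

  Invariance : Set
  Invariance = ∀ (g : Aut S) A B C → Base A → Ind A B C →
    let h = proj₁ g in Ind (image h A) (image h B) (image h C)

  Existence : Set
  Existence = ∀ A B C → Base A →
    (Σ (Aut S) λ g → Fixes (proj₁ g) A ×
        Ind A (image (proj₁ g) B) C) ×
    (Σ (Aut S) λ h → Fixes (proj₁ h) A ×
        Ind A B (image (proj₁ h) C))

  Stationarity : Set
  Stationarity =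
    (∀ A B B' C (g : Aut S) → Base A →
       Ind A B C → Ind A B' C →
       Fixes (proj₁ g) A → image (proj₁ g) B ≈ₛ B' →
       Σ (Aut S) λ h → Fixes (proj₁ h) (A ++ C) ×
         (∀ b → b ∈ B → Inverse.to (proj₁ h) b ≡ Inverse.to (proj₁ g) b)) ×
    (∀ A B C C' (g : Aut S) → Base A →
       Ind A B C → Ind A B C' →
       Fixes (proj₁ g) A → image (proj₁ g) C ≈ₛ C' →
       Σ (Aut S) λ h → Fixes (proj₁ h) (A ++ B) ×
         (∀ c → c ∈ C → Inverse.to (proj₁ h) c ≡ Inverse.to (proj₁ g) c))

  Monotonicity : Set
  Monotonicity =
    (∀ A B C D → Base A → Ind A (B ++ D) C → Ind A B C × Ind (A ++ B) D C) ×
    (∀ A B C D → Base A → Ind A B (C ++ D) → Ind A B C × Ind (A ++ C) B D)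

  Symmetric : Set
  Symmetric = ∀ A B C → Base A → Ind A B C → Ind A C B

  IsSWIRwrt : Set
  IsSWIRwrt = Extensional × Invariance × Existence × Stationarity × Monotonicity

AnyBase : List ℕ → Set
AnyBase _ = ⊤

NonEmptyBase : List ℕ → Set
NonEmptyBase A = A ≢ []

IsSWIR IsLocalSWIR IsSIR : ∀ {ar} → Structure ar → IndRel → Set
IsSWIR S Ind = IsSWIRwrt S AnyBase Ind
IsLocalSWIR S Ind = IsSWIRwrt S NonEmptyBase Ind
IsSIR S Ind = IsSWIR S Ind × Symmetric S AnyBase Ind

HasSWIR HasLocalSWIR HasSIR : ∀ {ar} → Structure ar → Set₁
HasSWIR S = Σ IndRel (IsSWIR S)
HasLocalSWIR S = Σ IndRel (IsLocalSWIR S)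
HasSIR S = Σ IndRel (IsSIR S)

HasFiniteSIRExpansion : (ℕ → ℕ → Bool) → Set₁
HasFiniteSIRExpansion E = Σ (List ℕ) λ ar → Σ (Structure ar) λ S →
  Ultrahomogeneous (expand E ar S) × HasSIR (expand E ar S)

{-# OPTIONS --safe #-}

-- Write x ~ y when x and y lie in the same part. The positive results use pairwise independence
-- relations: B ⫝_A C holds when each b ∈ B ∖ A and c ∈ C ∖ A satisfy a condition Good A b c that
-- prescribes how b and c are joined. Good is chosen so that Good A b c and Good A b′ c, with b′ the
-- image of b under an automorphism fixing A, force b and b′ to see c alike; stationarity then
-- follows by gluing and ultrahomogeneity, and existence by realizing B one point at a time
-- through the one-point extension property of the generic structure.
--   n = ω:     b → c, unless b ~ c and the part of b meets A;
--   n = 2:     b → c or b ⊥ c; automorphisms fixing a point preserve both parts, so A ≠ ∅ is needed;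
--   n finite:  naming the parts by unary predicates, edges run from the smaller part to the larger,
--              which is symmetric.
-- For the negative results take a transversal t₀ → t₁ → ⋯ of the n parts. An independent copy b of
-- t₁ over {t₀} (over ∅ when n = 2) sees t₁, …, t_{n-1} (t₀, t₁ when n = 2) alike by stationarity,
-- so it lies in two of their parts at once or in none of the n parts.

module Submission where

open import Defs
open import Data.Nat using (ℕ; suc; _+_; _<_; z<s; s≤s) renaming (_≟_ to _≟ℕ_)
import Data.Nat.Properties as ℕ
open import Data.Bool using (Bool; true; false; not)
import Data.Bool as Bool
open import Data.Fin using (Fin) renaming (zero to fzero; suc to fsuc)
import Data.Fin as Fin
import Data.Fin.Properties as Fin
open import Data.Vec using (Vec; []; _∷_; lookup)
import Data.Vec as V
import Data.Vec.Properties as V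
open import Data.List using (List; []; _∷_; _++_; length; deduplicate)
import Data.List as L
import Data.List.Relation.Unary.All as All
open import Data.List.Relation.Unary.AllPairs using (AllPairs)
open import Data.List.Relation.Unary.Unique.Propositional using (Unique)
open import Data.List.Relation.Unary.Unique.DecPropositional.Properties _≟ℕ_ using (deduplicate-!)
open import Data.List.Relation.Unary.Any using (here; there; any?)
open import Data.List.Membership.Propositional using (_∈_; _∉_; find; lose)
open import Data.List.Membership.Propositional.Properties
  using (∈-++⁺ˡ; ∈-++⁺ʳ; ∈-++⁻; ∈-map⁺; ∈-map⁻; ∈-tabulate⁺; ∈-tabulate⁻; ∈-allFin; ∈-deduplicate⁺)
open import Data.List.Membership.DecPropositional _≟ℕ_ using (_∈?_)
open import Data.Product using (_×_; Σ; _,_; proj₁; proj₂; ∃)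
open import Data.Sum using (_⊎_; inj₁; inj₂)
open import Data.Unit using (⊤; tt)
open import Data.Empty using (⊥; ⊥-elim)
open import Relation.Nullary using (¬_; Dec; yes; no; does; ¬?; _×-dec_; _⊎-dec_)
open import Relation.Nullary.Decidable using (dec-true)
open import Relation.Binary.Definitions using (tri<; tri≈; tri>)
open import Relation.Binary.PropositionalEquality using (_≡_; _≢_; refl; sym; trans; cong; cong₂; subst)
open import Relation.Binary.Structures using (IsEquivalence)
open import Function using (id)
open import Function.Bundles using (_↔_; Inverse; Injection)
open import Function.Properties.Inverse using (Inverse⇒Injection)

infixr 9 _·_

_·_ : ∀ {ℓ} {P : ℕ ↔ ℕ → Set ℓ} → Σ (ℕ ↔ ℕ) P → ℕ → ℕ
g · x = Inverse.to (proj₁ g) x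

·-injective : ∀ {ℓ} {P : ℕ ↔ ℕ → Set ℓ} (g : Σ (ℕ ↔ ℕ) P) {x y} → g · x ≡ g · y → x ≡ y
·-injective g = Injection.injective (Inverse⇒Injection (proj₁ g))

true≢false : true ≢ false
true≢false ()

distinct-[] : Distinct []
distinct-[] ()

distinct-∷ : ∀ {k} {x} {xs : Vec ℕ k} → (∀ j → x ≢ lookup xs j) → Distinct xs → Distinct (x ∷ xs)
distinct-∷ x∉ d fzero    fzero    _ = refl
distinct-∷ x∉ d fzero    (fsuc j) e = ⊥-elim (x∉ j e)
distinct-∷ x∉ d (fsuc i) fzero    e = ⊥-elim (x∉ i (sym e))
distinct-∷ x∉ d (fsuc i) (fsuc j) e = cong fsuc (d i j e)

distinct₁ : ∀ x → Distinct (x ∷ [])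
distinct₁ x = distinct-∷ (λ ()) distinct-[]

distinct₂ : ∀ {x y} → x ≢ y → Distinct (x ∷ y ∷ [])
distinct₂ x≢y = distinct-∷ (λ { fzero → x≢y }) (distinct₁ _)

distinct₃ : ∀ {x y z} → x ≢ y → x ≢ z → y ≢ z → Distinct (x ∷ y ∷ z ∷ [])
distinct₃ x≢y x≢z y≢z = distinct-∷ (λ { fzero → x≢y ; (fsuc fzero) → x≢z }) (distinct₂ y≢z)

lookup-fromList-∈ : ∀ (xs : List ℕ) i → lookup (V.fromList xs) i ∈ xs
lookup-fromList-∈ (x ∷ xs) fzero    = here refl
lookup-fromList-∈ (x ∷ xs) (fsuc i) = there (lookup-fromList-∈ xs i)

index-fromList : ∀ {xs : List ℕ} {x} → x ∈ xs → ∃ λ i → lookup (V.fromList xs) i ≡ x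
index-fromList (here refl) = fzero , refl
index-fromList (there x∈) with i , eq ← index-fromList x∈ = fsuc i , eq

distinct-fromList : ∀ {xs : List ℕ} → Unique xs → Distinct (V.fromList xs)
distinct-fromList {x ∷ xs} (x∉ AllPairs.∷ u) =
  distinct-∷ (λ j → All.lookup x∉ (lookup-fromList-∈ xs j)) (distinct-fromList u)

module PartiteFacts (n : Card) (E : ℕ → ℕ → Bool) (age : AgeIn n E) where

  infix 4 _~_ _~?_

  _~_ : ℕ → ℕ → Set
  _~_ = PerpOrEq E

  E-irrefl : ∀ x → E x x ≡ false
  E-irrefl x = proj₁ (proj₁ (age 1 (x ∷ []) (distinct₁ x))) fzero

  E⇒≢ : ∀ {x y} → E x y ≡ true → x ≢ y
  E⇒≢ {x} h refl = true≢false (trans (sym h) (E-irrefl x))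

  E-asym : ∀ x y → E x y ≡ true → E y x ≡ false
  E-asym x y h = proj₂ (proj₁ (age 2 (x ∷ y ∷ []) (distinct₂ (E⇒≢ h)))) fzero (fsuc fzero) h

  ~-sym : ∀ {x y} → x ~ y → y ~ x
  ~-sym (inj₁ refl) = inj₁ refl
  ~-sym (inj₂ (x≢y , xy , yx)) = inj₂ ((λ e → x≢y (sym e)) , yx , xy)

  ~-trans : ∀ {x y z} → x ~ y → y ~ z → x ~ z
  ~-trans (inj₁ refl) q = q
  ~-trans p (inj₁ refl) = p
  ~-trans {x} {y} {z} (inj₂ (x≢y , xy , yx)) (inj₂ (y≢z , yz , zy)) with x ≟ℕ z
  ... | yes x≡z = inj₁ x≡z
  ... | no x≢z
    with IsEquivalence.trans (proj₁ (proj₂ (age 3 (x ∷ y ∷ z ∷ []) (distinct₃ x≢y x≢z y≢z))))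
           {fzero} {fsuc fzero} {fsuc (fsuc fzero)} (inj₂ ((λ ()) , xy , yx)) (inj₂ ((λ ()) , yz , zy))
  ... | inj₂ (_ , xz , zx) = inj₂ (x≢z , xz , zx)

  E⇒≁ : ∀ {x y} → E x y ≡ true → ¬ (x ~ y)
  E⇒≁ h (inj₁ refl) = E⇒≢ h refl
  E⇒≁ h (inj₂ (_ , xy , _)) = true≢false (trans (sym h) xy)

  ≢∧~⇒noEdges : ∀ {x y} → x ≢ y → x ~ y → E x y ≡ false × E y x ≡ false
  ≢∧~⇒noEdges x≢y (inj₁ x≡y) = ⊥-elim (x≢y x≡y)
  ≢∧~⇒noEdges _   (inj₂ (_ , xy , yx)) = xy , yx

  ≢∧≁⇒E-flip : ∀ {x y} → x ≢ y → ¬ (x ~ y) → E y x ≡ not (E x y)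
  ≢∧≁⇒E-flip {x} {y} x≢y x≁y = exactly-one (E-asym x y) λ (xy , yx) → x≁y (inj₂ (x≢y , xy , yx))
    where
    exactly-one : ∀ {a b} → (a ≡ true → b ≡ false) → ¬ (a ≡ false × b ≡ false) → b ≡ not a
    exactly-one {true}  {true}  a⇒¬b _ = ⊥-elim (true≢false (a⇒¬b refl))
    exactly-one {true}  {false} _ _ = refl
    exactly-one {false} {true}  _ _ = refl
    exactly-one {false} {false} _ ¬both = ⊥-elim (¬both (refl , refl))

  _~?_ : ∀ x y → Dec (x ~ y)
  x ~? y = x ≟ℕ y ⊎-dec (¬? (x ≟ℕ y) ×-dec E x y Bool.≟ false ×-dec E y x Bool.≟ false)

  induced-~ : ∀ {k} (xs : Vec ℕ k) → Distinct xs → ∀ {i j} →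
    PerpOrEq (induced E xs) i j → lookup xs i ~ lookup xs j
  induced-~ xs d (inj₁ refl) = inj₁ refl
  induced-~ xs d (inj₂ (i≢j , ij , ji)) = inj₂ ((λ e → i≢j (d _ _ e)) , ij , ji)

  ~-induced : ∀ {k} (xs : Vec ℕ k) → Distinct xs → ∀ {i j} →
    lookup xs i ~ lookup xs j → PerpOrEq (induced E xs) i j
  ~-induced xs d (inj₁ e) = inj₁ (d _ _ e)
  ~-induced xs d (inj₂ (x≢y , xy , yx)) = inj₂ ((λ i≡j → x≢y (cong (lookup xs) i≡j)) , xy , yx)

  no-large-antichain : ∀ {m} → n ≡ fin m → (xs : Vec ℕ (suc m)) → Distinct xs →
    (∀ i j → i ≢ j → ¬ (lookup xs i ~ lookup xs j)) → ⊥
  no-large-antichain {m} refl xs d antichain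
    with part , part-ok ← proj₂ (proj₂ (age (suc m) xs d))
    with i , j , i<j , same ← Fin.pigeonhole (ℕ.n<1+n m) part
    = antichain i j (Fin.<⇒≢ i<j) (induced-~ xs d (proj₂ (part-ok i j) same))

module Homogeneity (E : ℕ → ℕ → Bool) (uh : Ultrahomogeneous (graphStr E)) where

  aut-E : (g : Aut (graphStr E)) → ∀ x y → E (g · x) (g · y) ≡ E x y
  aut-E g x y = proj₂ g fzero (x ∷ y ∷ [])

  extend-Vec : ∀ {k} (xs ys : Vec ℕ k) →
    (∀ i j → lookup xs i ≡ lookup xs j → lookup ys i ≡ lookup ys j) →
    (∀ i j → lookup ys i ≡ lookup ys j → lookup xs i ≡ lookup xs j) →
    (∀ i j → E (lookup xs i) (lookup xs j) ≡ E (lookup ys i) (lookup ys j)) →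
    Σ (Aut (graphStr E)) λ g → ∀ i → g · lookup xs i ≡ lookup ys i
  extend-Vec {k} xs ys p q r = uh k xs ys (p , q , λ { fzero (i ∷ j ∷ []) → r i j })

  extend-List : (xs : List ℕ) (φ : ℕ → ℕ) →
    (∀ {x y} → x ∈ xs → y ∈ xs → φ x ≡ φ y → x ≡ y) →
    (∀ {x y} → x ∈ xs → y ∈ xs → E (φ x) (φ y) ≡ E x y) →
    Σ (Aut (graphStr E)) λ g → ∀ {x} → x ∈ xs → g · x ≡ φ x
  extend-List xs φ inj pres = g , λ x∈ → let i , eq = index-fromList x∈ in
      trans (cong (g ·_) (sym eq)) (trans (g-ok i) (trans (φ∘ i) (cong φ eq)))
    where
    vs = V.fromList xs
    φ∘ : ∀ i → lookup (V.map φ vs) i ≡ φ (lookup vs i)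
    φ∘ i = V.lookup-map i φ vs
    resp : ∀ i j → lookup vs i ≡ lookup vs j → lookup (V.map φ vs) i ≡ lookup (V.map φ vs) j
    resp i j e = trans (φ∘ i) (trans (cong φ e) (sym (φ∘ j)))
    refl′ : ∀ i j → lookup (V.map φ vs) i ≡ lookup (V.map φ vs) j → lookup vs i ≡ lookup vs j
    refl′ i j e = inj (lookup-fromList-∈ xs i) (lookup-fromList-∈ xs j) (trans (sym (φ∘ i)) (trans e (φ∘ j)))
    pres′ : ∀ i j → E (lookup vs i) (lookup vs j) ≡ E (lookup (V.map φ vs) i) (lookup (V.map φ vs) j)
    pres′ i j = sym (trans (cong₂ E (φ∘ i) (φ∘ j)) (pres (lookup-fromList-∈ xs i) (lookup-fromList-∈ xs j)))
    extension = extend-Vec vs (V.map φ vs) resp refl′ pres′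
    g = proj₁ extension
    g-ok = proj₂ extension

module OnePointExtension (n : Card) (E : ℕ → ℕ → Bool) (gen : IsGenericPartiteTournament n E) where
  open PartiteFacts n E (proj₁ gen) public
  open Homogeneity E (proj₂ (proj₂ gen)) public

  -- A new point may only open a part of its own when there are infinitely many parts.
  data Part (D : List ℕ) : Set where
    partOf  : (d₀ : ℕ) → d₀ ∈ D → Part D
    newPart : n ≡ ω → Part D

  InPart : ∀ {D} → Part D → ℕ → Set
  InPart (partOf d₀ _) d = d ~ d₀
  InPart (newPart _)   d = ⊥

  InPart? : ∀ {D} (P : Part D) d → Dec (InPart P d)
  InPart? (partOf d₀ _) d = d ~? d₀
  InPart? (newPart _)   d = no λ ()

  InPart-resp-~ : ∀ {D} (P : Part D) {d d′} → InPart P d → d ~ d′ → InPart P d′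
  InPart-resp-~ (partOf d₀ _) d~d₀ d~d′ = ~-trans (~-sym d~d′) d~d₀

  InPart⇒~ : ∀ {D} (P : Part D) {d d′} → InPart P d → InPart P d′ → d ~ d′
  InPart⇒~ (partOf d₀ _) d~d₀ d′~d₀ = ~-trans d~d₀ (~-sym d′~d₀)

  part-representative : ∀ {D m} (P : Part D) → n ≡ fin m →
    ∃ λ d₀ → d₀ ∈ D × (∀ {d} → InPart P d → d ~ d₀) × (∀ {d} → d ~ d₀ → InPart P d)
  part-representative (partOf d₀ d₀∈) _ = d₀ , d₀∈ , (λ p → p) , (λ p → p)
  part-representative (newPart n≡ω) n≡m with () ← trans (sym n≡m) n≡ω

  Realizes : (D : List ℕ) → Part D → (ℕ → Bool) → ℕ → Set
  Realizes D P dir w = w ∉ D × (∀ {d} → d ∈ D →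
    (InPart P d → Perp E w d) × (¬ InPart P d → E w d ≡ dir d × E d w ≡ not (dir d)))

  -- The finite partite tournament that the new point w (index 0) must form with D.
  module ExtensionTournament (D : List ℕ) (P : Part D) (dir : ℕ → Bool) where

    k : ℕ
    k = length (deduplicate _≟ℕ_ D)

    vs : Vec ℕ k
    vs = V.fromList (deduplicate _≟ℕ_ D)

    v : Fin k → ℕ
    v = lookup vs

    vs-distinct : Distinct vs
    vs-distinct = distinct-fromList (deduplicate-! D)

    v-index : ∀ {d} → d ∈ D → ∃ λ i → v i ≡ d
    v-index d∈ = index-fromList (∈-deduplicate⁺ _≟ℕ_ d∈)

    from-w to-w : ℕ → Bool
    from-w d with InPart? P d
    ... | yes _ = false
    ... | no  _ = dir d
    to-w d with InPart? P d
    ... | yes _ = false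
    ... | no  _ = not (dir d)

    from-w-in : ∀ {d} → InPart P d → from-w d ≡ false
    from-w-in {d} p with InPart? P d
    ... | yes _ = refl
    ... | no ¬p = ⊥-elim (¬p p)

    to-w-in : ∀ {d} → InPart P d → to-w d ≡ false
    to-w-in {d} p with InPart? P d
    ... | yes _ = refl
    ... | no ¬p = ⊥-elim (¬p p)

    from-w-out : ∀ {d} → ¬ InPart P d → from-w d ≡ dir d
    from-w-out {d} ¬p with InPart? P d
    ... | yes p = ⊥-elim (¬p p)
    ... | no _ = refl

    to-w-out : ∀ {d} → ¬ InPart P d → to-w d ≡ not (dir d)
    to-w-out {d} ¬p with InPart? P d
    ... | yes p = ⊥-elim (¬p p)
    ... | no _ = refl

    e : Fin (suc k) → Fin (suc k) → Bool
    e fzero    fzero    = false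
    e fzero    (fsuc j) = from-w (v j)
    e (fsuc i) fzero    = to-w (v i)
    e (fsuc i) (fsuc j) = E (v i) (v j)

    e-oriented : IsOriented e
    e-oriented = irrefl , asym
      where
      irrefl : ∀ x → e x x ≡ false
      irrefl fzero    = refl
      irrefl (fsuc i) = E-irrefl (v i)
      asym : ∀ x y → e x y ≡ true → e y x ≡ false
      asym fzero    (fsuc j) h with InPart? P (v j)
      ... | yes _ = refl
      ... | no  _ rewrite h = refl
      asym (fsuc i) fzero    h with InPart? P (v i)
      ... | yes _ = refl
      ... | no  _ with dir (v i)
      ...   | false = refl
      asym (fsuc i) (fsuc j) h = E-asym (v i) (v j) h

    SamePart : Fin (suc k) → Fin (suc k) → Set
    SamePart fzero    fzero    = ⊤
    SamePart fzero    (fsuc j) = InPart P (v j)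
    SamePart (fsuc i) fzero    = InPart P (v i)
    SamePart (fsuc i) (fsuc j) = v i ~ v j

    SamePart-refl : ∀ x → SamePart x x
    SamePart-refl fzero    = tt
    SamePart-refl (fsuc i) = inj₁ refl

    SamePart-trans : ∀ x y z → SamePart x y → SamePart y z → SamePart x z
    SamePart-trans fzero    fzero    z        _ q = q
    SamePart-trans fzero    (fsuc j) fzero    _ _ = tt
    SamePart-trans fzero    (fsuc j) (fsuc l) p q = InPart-resp-~ P p q
    SamePart-trans (fsuc i) fzero    fzero    p _ = p
    SamePart-trans (fsuc i) fzero    (fsuc l) p q = InPart⇒~ P p q
    SamePart-trans (fsuc i) (fsuc j) fzero    p q = InPart-resp-~ P q (~-sym p)
    SamePart-trans (fsuc i) (fsuc j) (fsuc l) p q = ~-trans p q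

    perp⇒SamePart : ∀ x y → PerpOrEq e x y → SamePart x y
    perp⇒SamePart x .x (inj₁ refl) = SamePart-refl x
    perp⇒SamePart fzero    fzero    (inj₂ _) = tt
    perp⇒SamePart fzero    (fsuc j) (inj₂ (_ , wd , dw)) with InPart? P (v j)
    ... | yes p = p
    ... | no  _ with dir (v j)
    ...   | false = ⊥-elim (true≢false dw)
    ...   | true  = ⊥-elim (true≢false wd)
    perp⇒SamePart (fsuc i) fzero    (inj₂ (_ , dw , wd)) with InPart? P (v i)
    ... | yes p = p
    ... | no  _ with dir (v i)
    ...   | false = ⊥-elim (true≢false dw)
    ...   | true  = ⊥-elim (true≢false wd)
    perp⇒SamePart (fsuc i) (fsuc j) (inj₂ (i≢j , ij , ji)) =
      induced-~ vs vs-distinct (inj₂ ((λ i≡j → i≢j (cong fsuc i≡j)) , ij , ji))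

    SamePart⇒perp : ∀ x y → SamePart x y → PerpOrEq e x y
    SamePart⇒perp fzero    fzero    _ = inj₁ refl
    SamePart⇒perp fzero    (fsuc j) p = inj₂ ((λ ()) , from-w-in p , to-w-in p)
    SamePart⇒perp (fsuc i) fzero    p = inj₂ ((λ ()) , to-w-in p , from-w-in p)
    SamePart⇒perp (fsuc i) (fsuc j) p with ~-induced vs vs-distinct p
    ... | inj₁ refl = inj₁ refl
    ... | inj₂ (i≢j , ij , ji) = inj₂ ((λ q → i≢j (Fin.suc-injective q)) , ij , ji)

    e-equivalence : IsEquivalence (PerpOrEq e)
    e-equivalence = record
      { refl  = inj₁ refl
      ; sym   = λ { (inj₁ refl) → inj₁ refl ; (inj₂ (x≢y , xy , yx)) → inj₂ ((λ q → x≢y (sym q)) , yx , xy) }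
      ; trans = λ {x} {y} {z} p q →
          SamePart⇒perp x z (SamePart-trans x y z (perp⇒SamePart x y p) (perp⇒SamePart y z q))
      }

    e-classes : ∀ {n′} → n ≡ n′ → AtMostClasses e n′
    e-classes {ω} _ = tt
    e-classes {fin m} n≡m =
      part , λ x y → (λ p → SamePart⇒part x y (perp⇒SamePart x y p)) , (λ q → SamePart⇒perp x y (part⇒SamePart x y q))
      where
      representative = part-representative P n≡m
      d₀ = proj₁ representative
      d₀∈ = proj₁ (proj₂ representative)
      in⇒~d₀ = proj₁ (proj₂ (proj₂ representative))
      ~d₀⇒in = proj₂ (proj₂ (proj₂ representative))
      vs-classes = subst (AtMostClasses (induced E vs)) n≡m (proj₂ (proj₂ (proj₁ gen k vs vs-distinct)))
      c = proj₁ vs-classes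
      c-ok = proj₂ vs-classes
      j₀ = proj₁ (v-index d₀∈)
      vj₀≡d₀ = proj₂ (v-index d₀∈)
      part : Fin (suc k) → Fin m
      part fzero    = c j₀
      part (fsuc i) = c i
      ~⇒c : ∀ {i j} → v i ~ v j → c i ≡ c j
      ~⇒c p = proj₁ (c-ok _ _) (~-induced vs vs-distinct p)
      c⇒~ : ∀ {i j} → c i ≡ c j → v i ~ v j
      c⇒~ q = induced-~ vs vs-distinct (proj₂ (c-ok _ _) q)
      ~d₀ : ∀ {i} → v i ~ d₀ → v i ~ v j₀
      ~d₀ p = subst (_ ~_) (sym vj₀≡d₀) p
      d₀~ : ∀ {i} → v i ~ v j₀ → v i ~ d₀
      d₀~ p = subst (_ ~_) vj₀≡d₀ p
      SamePart⇒part : ∀ x y → SamePart x y → part x ≡ part y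
      SamePart⇒part fzero    fzero    _ = refl
      SamePart⇒part fzero    (fsuc j) p = sym (~⇒c (~d₀ (in⇒~d₀ p)))
      SamePart⇒part (fsuc i) fzero    p = ~⇒c (~d₀ (in⇒~d₀ p))
      SamePart⇒part (fsuc i) (fsuc j) p = ~⇒c p
      part⇒SamePart : ∀ x y → part x ≡ part y → SamePart x y
      part⇒SamePart fzero    fzero    _ = tt
      part⇒SamePart fzero    (fsuc j) q = ~d₀⇒in (d₀~ (c⇒~ (sym q)))
      part⇒SamePart (fsuc i) fzero    q = ~d₀⇒in (d₀~ (c⇒~ q))
      part⇒SamePart (fsuc i) (fsuc j) q = c⇒~ q

    e-isPartiteTournament : IsPartiteTournament e n
    e-isPartiteTournament = e-oriented , e-equivalence , e-classes refl

    realization : ∃ (Realizes D P dir)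
    realization
      with x₀ ∷ xs , xs-distinct , xs-edges ← proj₁ (proj₂ gen) (suc k) e e-isPartiteTournament
      with g , g-ok ← extend-Vec xs vs
             (λ i j q → cong v (Fin.suc-injective (xs-distinct (fsuc i) (fsuc j) q)))
             (λ i j q → cong (lookup xs) (vs-distinct i j q))
             (λ i j → xs-edges (fsuc i) (fsuc j))
      = g · x₀ , w∉D , w-edges
      where
      w∉D : g · x₀ ∉ D
      w∉D w∈D with j , vj≡w ← v-index w∈D
        with () ← xs-distinct (fsuc j) fzero (·-injective g (trans (g-ok j) vj≡w))
      edge-to : ∀ j → E (g · x₀) (v j) ≡ from-w (v j)
      edge-to j = trans (cong (E (g · x₀)) (sym (g-ok j)))
                        (trans (aut-E g x₀ (lookup xs j)) (xs-edges fzero (fsuc j)))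
      edge-from : ∀ j → E (v j) (g · x₀) ≡ to-w (v j)
      edge-from j = trans (cong (λ t → E t (g · x₀)) (sym (g-ok j)))
                          (trans (aut-E g (lookup xs j) x₀) (xs-edges (fsuc j) fzero))
      w-edges : ∀ {d} → d ∈ D → (InPart P d → Perp E (g · x₀) d) ×
                                (¬ InPart P d → E (g · x₀) d ≡ dir d × E d (g · x₀) ≡ not (dir d))
      w-edges d∈D with j , refl ← v-index d∈D =
        (λ p → (λ w≡d → w∉D (subst (_∈ D) (sym w≡d) d∈D)) ,
               trans (edge-to j) (from-w-in p) , trans (edge-from j) (to-w-in p)) ,
        (λ ¬p → trans (edge-to j) (from-w-out ¬p) , trans (edge-from j) (to-w-out ¬p))

  onePointExtension : ∀ D (P : Part D) (dir : ℕ → Bool) → ∃ (Realizes D P dir)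
  onePointExtension D P dir = ExtensionTournament.realization D P dir

module SWIRProperties {ar} (S : Structure ar) {Base : List ℕ → Set} {Ind : IndRel}
                      (swir : IsSWIRwrt S Base Ind) where

  extensional : Extensional S Base Ind
  extensional = proj₁ swir

  existence : Existence S Base Ind
  existence = proj₁ (proj₂ (proj₂ swir))

  stationarity : Stationarity S Base Ind
  stationarity = proj₁ (proj₂ (proj₂ (proj₂ swir)))

  monotonicity : Monotonicity S Base Ind
  monotonicity = proj₂ (proj₂ (proj₂ (proj₂ swir)))

  independent-∈ʳ : ∀ {A B C c} → Base A → Ind A B C → c ∈ C → Ind A B (c ∷ [])
  independent-∈ʳ {A} {B} {C} {c} base ind c∈C =
    proj₁ (proj₂ monotonicity A B (c ∷ []) C base
      (extensional A A B B C (c ∷ C) base (λ _ → id , id) (λ _ → id , id)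
        (λ _ → there , λ { (here refl) → c∈C ; (there p) → p }) ind))

<-tournament : ∀ {m} → Fin m → Fin m → Bool
<-tournament i j with i Fin.<? j
... | yes _ = true
... | no  _ = false

<-tournament-true : ∀ {m} {i j : Fin m} → i Fin.< j → <-tournament i j ≡ true
<-tournament-true {i = i} {j} i<j with i Fin.<? j
... | yes _ = refl
... | no i≮j = ⊥-elim (i≮j i<j)

<-tournament-true⁻ : ∀ {m} {i j : Fin m} → <-tournament i j ≡ true → i Fin.< j
<-tournament-true⁻ {i = i} {j} ij with i Fin.<? j
... | yes i<j = i<j

<-tournament-false : ∀ {m} {i j : Fin m} → ¬ i Fin.< j → <-tournament i j ≡ false
<-tournament-false {i = i} {j} i≮j with i Fin.<? j
... | yes i<j = ⊥-elim (i≮j i<j)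
... | no _ = refl

<-tournament-flip : ∀ {m} {i j : Fin m} → i ≢ j → <-tournament j i ≡ not (<-tournament i j)
<-tournament-flip {i = i} {j} i≢j with Fin.<-cmp i j
... | tri< i<j _ j≮i = trans (<-tournament-false j≮i) (cong not (sym (<-tournament-true i<j)))
... | tri≈ _ i≡j _   = ⊥-elim (i≢j i≡j)
... | tri> i≮j _ j<i = trans (<-tournament-true j<i) (cong not (sym (<-tournament-false i≮j)))

<-tournament-irrefl : ∀ {m} (i : Fin m) → <-tournament i i ≡ false
<-tournament-irrefl i = <-tournament-false (Fin.<-irrefl refl)

<-tournament-≡ : ∀ {m} {i j : Fin m} → PerpOrEq <-tournament i j → i ≡ j
<-tournament-≡ (inj₁ i≡j) = i≡j
<-tournament-≡ {i = i} {j} (inj₂ (_ , ij , ji)) with Fin.<-cmp i j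
... | tri< i<j _ _ = ⊥-elim (true≢false (trans (sym (<-tournament-true i<j)) ij))
... | tri≈ _ i≡j _ = i≡j
... | tri> _ _ j<i = ⊥-elim (true≢false (trans (sym (<-tournament-true j<i)) ji))

<-tournament-isPartiteTournament : ∀ m → IsPartiteTournament (<-tournament {m}) (fin m)
<-tournament-isPartiteTournament m =
  ((λ i → <-tournament-false (Fin.<-irrefl refl)) ,
   (λ i j ij → <-tournament-false (λ j<i → Fin.<-asym j<i (<-tournament-true⁻ ij)))) ,
  record { refl = inj₁ refl
         ; sym = λ p → inj₁ (sym (<-tournament-≡ p))
         ; trans = λ p q → inj₁ (trans (<-tournament-≡ p) (<-tournament-≡ q)) } ,
  (λ i → i) , λ i j → <-tournament-≡ , inj₁

module Transversal (m : ℕ) (E : ℕ → ℕ → Bool) (gen : IsGenericPartiteTournament (fin m) E) where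
  open PartiteFacts (fin m) E (proj₁ gen) public
  open Homogeneity E (proj₂ (proj₂ gen)) public

  private
    copy : Σ (Vec ℕ m) λ xs → Distinct xs × (∀ i j → E (lookup xs i) (lookup xs j) ≡ <-tournament i j)
    copy = proj₁ (proj₂ gen) m <-tournament (<-tournament-isPartiteTournament m)

  t : Fin m → ℕ
  t = lookup (proj₁ copy)

  t-edge : ∀ {i j} → i Fin.< j → E (t i) (t j) ≡ true
  t-edge i<j = trans (proj₂ (proj₂ copy) _ _) (<-tournament-true i<j)

  t≁ : ∀ {i j} → i ≢ j → ¬ (t i ~ t j)
  t≁ {i} {j} i≢j ti~tj with Fin.<-cmp i j
  ... | tri< i<j _ _ = E⇒≁ (t-edge i<j) ti~tj
  ... | tri≈ _ i≡j _ = i≢j i≡j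
  ... | tri> _ _ j<i = E⇒≁ (t-edge j<i) (~-sym ti~tj)

  t-meets-every-part : ∀ x → ¬ (∀ i → ¬ (x ~ t i))
  t-meets-every-part x x≁t = no-large-antichain refl (x ∷ proj₁ copy)
    (distinct-∷ (λ j x≡tj → x≁t j (inj₁ x≡tj)) (proj₁ (proj₂ copy))) antichain
    where
    antichain : ∀ i j → i ≢ j → ¬ (lookup (x ∷ proj₁ copy) i ~ lookup (x ∷ proj₁ copy) j)
    antichain fzero    fzero    i≢j _ = i≢j refl
    antichain fzero    (fsuc j) _   p = x≁t j p
    antichain (fsuc i) fzero    _   p = x≁t i (~-sym p)
    antichain (fsuc i) (fsuc j) i≢j p = t≁ (λ i≡j → i≢j (cong fsuc i≡j)) p

  SameEdges : ℕ → ℕ → ℕ → Set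
  SameEdges b x y = E b x ≡ E b y × E x b ≡ E y b

  ~-transfer : ∀ {b x y} → SameEdges b x y → b ~ x → b ~ y
  ~-transfer {b} {x} {y} (bx≡by , xb≡yb) b~x with b ≟ℕ y
  ... | yes b≡y = inj₁ b≡y
  ... | no b≢y =
    inj₂ (b≢y , trans (sym bx≡by) (proj₁ (no-edges b~x)) , trans (sym xb≡yb) (proj₂ (no-edges b~x)))
    where
    no-edges : b ~ x → E b x ≡ false × E x b ≡ false
    no-edges (inj₁ refl) = E-irrefl b , E-irrefl b
    no-edges (inj₂ (_ , bx , xb)) = bx , xb

  -- b either shares the part of t j₀, and then also that of t j₁, or lies in none of the parts of t.
  no-uniform-vertex : ∀ b {j₀ j₁} → j₀ ≢ j₁ → SameEdges b (t j₁) (t j₀) →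
    (∀ i → SameEdges b (t i) (t j₀) ⊎ ¬ (b ~ t i)) → ⊥
  no-uniform-vertex b {j₀} {j₁} j₀≢j₁ uniform₁ uniform with b ~? t j₀
  ... | yes b~tj₀ = t≁ j₀≢j₁ (~-trans (~-sym b~tj₀) (~-transfer (swap uniform₁) b~tj₀))
    where
    swap : ∀ {x y} → SameEdges b x y → SameEdges b y x
    swap (p , q) = sym p , sym q
  ... | no b≁tj₀ = t-meets-every-part b λ i → case (uniform i)
    where
    case : ∀ {i} → SameEdges b (t i) (t j₀) ⊎ ¬ (b ~ t i) → ¬ (b ~ t i)
    case (inj₁ same) b~ti = b≁tj₀ (~-transfer same b~ti)
    case (inj₂ b≁ti) = b≁ti

  extend-≅₁ : ∀ x y → Σ (Aut (graphStr E)) λ g → g · x ≡ y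
  extend-≅₁ x y with g , g-ok ← extend-Vec (x ∷ []) (y ∷ [])
                       (λ { fzero fzero _ → refl }) (λ { fzero fzero _ → refl })
                       (λ { fzero fzero → trans (E-irrefl x) (sym (E-irrefl y)) })
    = g , g-ok fzero

  extend-≅₂ : ∀ {x y x′ y′} → x ≢ y → x′ ≢ y′ → E x y ≡ E x′ y′ → E y x ≡ E y′ x′ →
    Σ (Aut (graphStr E)) λ g → g · x ≡ x′ × g · y ≡ y′
  extend-≅₂ {x} {y} {x′} {y′} x≢y x′≢y′ xy yx = proj₁ ext , proj₂ ext fzero , proj₂ ext (fsuc fzero)
    where
    resp : ∀ {a b c d} → a ≢ b → ∀ i j → lookup (a ∷ b ∷ []) i ≡ lookup (a ∷ b ∷ []) j →
      lookup (c ∷ d ∷ []) i ≡ lookup (c ∷ d ∷ []) j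
    resp a≢b fzero        fzero        _ = refl
    resp a≢b fzero        (fsuc fzero) e = ⊥-elim (a≢b e)
    resp a≢b (fsuc fzero) fzero        e = ⊥-elim (a≢b (sym e))
    resp a≢b (fsuc fzero) (fsuc fzero) _ = refl
    edges : ∀ i j → E (lookup (x ∷ y ∷ []) i) (lookup (x ∷ y ∷ []) j) ≡
                    E (lookup (x′ ∷ y′ ∷ []) i) (lookup (x′ ∷ y′ ∷ []) j)
    edges fzero        fzero        = trans (E-irrefl x) (sym (E-irrefl x′))
    edges fzero        (fsuc fzero) = xy
    edges (fsuc fzero) fzero        = yx
    edges (fsuc fzero) (fsuc fzero) = trans (E-irrefl y) (sym (E-irrefl y′))
    ext = extend-Vec (x ∷ y ∷ []) (x′ ∷ y′ ∷ []) (resp x≢y) (resp x′≢y′) edges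

  module _ {Base : List ℕ → Set} {Ind : IndRel} (swir : IsSWIRwrt (graphStr E) Base Ind) where
    open SWIRProperties (graphStr E) swir

    stationary-SameEdges : ∀ {A b c c′} → Base A → Ind A (b ∷ []) (c ∷ []) → Ind A (b ∷ []) (c′ ∷ []) →
      (g : Aut (graphStr E)) → Fixes (proj₁ g) A → g · c ≡ c′ → SameEdges b c′ c
    stationary-SameEdges {A} {b} {c} {c′} base ind ind′ g g-fixes gc≡c′ =
      trans (cong₂ E (sym hb) (sym hc)) (aut-E h b c) , trans (cong₂ E (sym hc) (sym hb)) (aut-E h c b)
      where
      moved : image (proj₁ g) (c ∷ []) ≈ₛ (c′ ∷ [])
      moved _ = (λ { (here p) → here (trans p gc≡c′) }) , (λ { (here p) → here (trans p (sym gc≡c′)) })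
      stat = proj₂ stationarity A (b ∷ []) (c ∷ []) (c′ ∷ []) g base ind ind′ g-fixes moved
      h = proj₁ stat
      hb : h · b ≡ b
      hb = proj₁ (proj₂ stat) b (∈-++⁺ʳ A (here refl))
      hc : h · c ≡ c′
      hc = trans (proj₂ (proj₂ stat) c (here refl)) gc≡c′

bipartite-noSWIR : ∀ E → IsGenericPartiteTournament (fin 2) E → ¬ HasSWIR (graphStr E)
bipartite-noSWIR E gen (Ind , swir) =
  no-uniform-vertex b {fzero} {fsuc fzero} (λ ()) same uniform
  where
  open Transversal 2 E gen
  open SWIRProperties (graphStr E) swir
  copy = proj₁ (existence [] (t fzero ∷ []) (t fzero ∷ t (fsuc fzero) ∷ []) tt)
  b = proj₁ copy · t fzero
  ind = proj₂ (proj₂ copy)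
  t₀↦t₁ = extend-≅₁ (t fzero) (t (fsuc fzero))
  same : SameEdges b (t (fsuc fzero)) (t fzero)
  same = stationary-SameEdges swir tt (independent-∈ʳ tt ind (here refl))
           (independent-∈ʳ tt ind (there (here refl))) (proj₁ t₀↦t₁) (λ _ ()) (proj₂ t₀↦t₁)
  uniform : ∀ i → SameEdges b (t i) (t fzero) ⊎ ¬ (b ~ t i)
  uniform fzero        = inj₁ (refl , refl)
  uniform (fsuc fzero) = inj₁ same

noLocalSWIR : ∀ k E → IsGenericPartiteTournament (fin (3 + k)) E → ¬ HasLocalSWIR (graphStr E)
noLocalSWIR k E gen (Ind , swir) =
  no-uniform-vertex b {fsuc fzero} {fsuc (fsuc fzero)} (λ ()) (same (fsuc fzero)) uniform
  where
  open Transversal (3 + k) E gen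
  open SWIRProperties (graphStr E) swir
  t₀ = t fzero
  A = t₀ ∷ []
  A≢[] : NonEmptyBase A
  A≢[] ()
  copy = proj₁ (existence A (t (fsuc fzero) ∷ []) (L.map (λ j → t (fsuc j)) (L.allFin (2 + k))) A≢[])
  g = proj₁ copy
  b = g · t (fsuc fzero)
  ind : ∀ j → Ind A (b ∷ []) (t (fsuc j) ∷ [])
  ind j = independent-∈ʳ A≢[] (proj₂ (proj₂ copy)) (∈-map⁺ (λ j → t (fsuc j)) (∈-allFin j))
  t₀→b : E t₀ b ≡ true
  t₀→b = trans (cong (λ x → E x b) (sym (proj₁ (proj₂ copy) t₀ (here refl))))
               (trans (aut-E g t₀ (t (fsuc fzero))) (t-edge z<s))
  same : ∀ j → SameEdges b (t (fsuc j)) (t (fsuc fzero))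
  same j = stationary-SameEdges swir A≢[] (ind fzero) (ind j) (proj₁ t₁↦tj)
             (λ { _ (here refl) → proj₁ (proj₂ t₁↦tj) }) (proj₂ (proj₂ t₁↦tj))
    where
    t₁↦tj = extend-≅₂ (E⇒≢ (t-edge z<s)) (E⇒≢ (t-edge z<s))
              (trans (t-edge z<s) (sym (t-edge z<s)))
              (trans (E-asym _ _ (t-edge z<s)) (sym (E-asym _ _ (t-edge z<s))))
  uniform : ∀ i → SameEdges b (t i) (t (fsuc fzero)) ⊎ ¬ (b ~ t i)
  uniform fzero    = inj₂ λ b~t₀ → E⇒≁ t₀→b (~-sym b~t₀)
  uniform (fsuc j) = inj₁ (same j)

_[_↦_] : (ℕ → ℕ) → ℕ → ℕ → ℕ → ℕ
(φ [ b ↦ w ]) x with x ≟ℕ b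
... | yes _ = w
... | no  _ = φ x

↦-new : ∀ φ b w → (φ [ b ↦ w ]) b ≡ w
↦-new φ b w with b ≟ℕ b
... | yes _ = refl
... | no b≢b = ⊥-elim (b≢b refl)

↦-old : ∀ φ {b} w {x} → x ≢ b → (φ [ b ↦ w ]) x ≡ φ x
↦-old φ {b} w {x} x≢b with x ≟ℕ b
... | yes x≡b = ⊥-elim (x≢b x≡b)
... | no _ = refl

module IteratedExtension (n : Card) (E : ℕ → ℕ → Bool) (gen : IsGenericPartiteTournament n E)
                         (Same : ℕ → ℕ → Set) (Same-refl : ∀ x → Same x x) where
  open OnePointExtension n E gen public

  module Over (A : List ℕ) (Q : ℕ → Set) where

    record Embedding (Done : List ℕ) (φ : ℕ → ℕ) : Set where
      field
        fixes          : ∀ {a} → a ∈ A → φ a ≡ a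
        injective      : ∀ {x y} → x ∈ Done ++ A → y ∈ Done ++ A → φ x ≡ φ y → x ≡ y
        preserves-E    : ∀ {x y} → x ∈ Done ++ A → y ∈ Done ++ A → E (φ x) (φ y) ≡ E x y
        preserves-Same : ∀ {x} → x ∈ Done ++ A → Same (φ x) x
        into-Q         : ∀ {x} → x ∈ Done → Q (φ x)

    identity : Embedding [] (λ x → x)
    identity = record
      { fixes = λ _ → refl ; injective = λ _ _ e → e ; preserves-E = λ _ _ → refl
      ; preserves-Same = λ _ → Same-refl _ ; into-Q = λ () }

    ValidImage : List ℕ → (ℕ → ℕ) → ℕ → ℕ → Set
    ValidImage Dom φ b w = w ∉ L.map φ Dom ×
      (∀ {x} → x ∈ Dom → E w (φ x) ≡ E b x × E (φ x) w ≡ E x b) × Same w b × Q w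

    OnePointStep : Set
    OnePointStep = ∀ {Done φ} → Embedding Done φ → ∀ {b} → b ∉ Done ++ A → ∃ (ValidImage (Done ++ A) φ b)

    ↦-agrees : ∀ {Dom φ b} w {x} → b ∉ Dom → x ∈ Dom → (φ [ b ↦ w ]) x ≡ φ x
    ↦-agrees {Dom} {φ} w b∉ x∈ = ↦-old φ w (λ x≡b → b∉ (subst (_∈ Dom) x≡b x∈))

    embedding-∷ : ∀ {Done φ b w} → Embedding Done φ → b ∉ Done ++ A → ValidImage (Done ++ A) φ b w →
      Embedding (b ∷ Done) (φ [ b ↦ w ])
    embedding-∷ {Done} {φ} {b} {w} emb b∉ (w∉ , w-edges , w-Same , w-Q) = record
      { fixes          = λ a∈ → trans (old (∈-++⁺ʳ Done a∈)) (fixes a∈)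
      ; injective      = inj
      ; preserves-E    = pres
      ; preserves-Same = λ { (here refl) → subst (λ v → Same v b) (sym new) w-Same
                           ; (there x∈) → subst (λ v → Same v _) (sym (old x∈)) (preserves-Same x∈) }
      ; into-Q         = λ { (here refl) → subst Q (sym new) w-Q
                           ; (there x∈) → subst Q (sym (old (∈-++⁺ˡ x∈))) (into-Q x∈) }
      }
      where
      open Embedding emb
      ψ = φ [ b ↦ w ]
      new : ψ b ≡ w
      new = ↦-new φ b w
      old : ∀ {x} → x ∈ Done ++ A → ψ x ≡ φ x
      old = ↦-agrees w b∉
      w≢φ : ∀ {x} → x ∈ Done ++ A → w ≢ φ x
      w≢φ x∈ w≡φx = w∉ (subst (_∈ L.map φ (Done ++ A)) (sym w≡φx) (∈-map⁺ φ x∈))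
      inj : ∀ {x y} → x ∈ b ∷ Done ++ A → y ∈ b ∷ Done ++ A → ψ x ≡ ψ y → x ≡ y
      inj (here refl) (here refl) _ = refl
      inj (here refl) (there y∈)  e = ⊥-elim (w≢φ y∈ (trans (sym new) (trans e (old y∈))))
      inj (there x∈)  (here refl) e = ⊥-elim (w≢φ x∈ (trans (sym new) (trans (sym e) (old x∈))))
      inj (there x∈)  (there y∈)  e = injective x∈ y∈ (trans (sym (old x∈)) (trans e (old y∈)))
      pres : ∀ {x y} → x ∈ b ∷ Done ++ A → y ∈ b ∷ Done ++ A → E (ψ x) (ψ y) ≡ E x y
      pres (here refl) (here refl) = trans (cong₂ E new new) (trans (E-irrefl w) (sym (E-irrefl b)))
      pres (here refl) (there y∈)  = trans (cong₂ E new (old y∈)) (proj₁ (w-edges y∈))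
      pres (there x∈)  (here refl) = trans (cong₂ E (old x∈) new) (proj₂ (w-edges x∈))
      pres (there x∈)  (there y∈)  = trans (cong₂ E (old x∈) (old y∈)) (preserves-E x∈ y∈)

    record ExtensionAlong (Rest Done : List ℕ) (φ : ℕ → ℕ) : Set where
      field
        Done′     : List ℕ
        φ′        : ℕ → ℕ
        embedding : Embedding Done′ φ′
        covers    : ∀ {x} → x ∈ Rest → x ∈ Done′ ++ A
        keeps     : ∀ {x} → x ∈ Done ++ A → x ∈ Done′ ++ A × φ′ x ≡ φ x

    extend-along : OnePointStep → ∀ Rest {Done φ} → Embedding Done φ → ExtensionAlong Rest Done φ
    extend-along step [] {Done} {φ} emb = record
      { Done′ = Done ; φ′ = φ ; embedding = emb ; covers = λ () ; keeps = λ x∈ → x∈ , refl }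
    extend-along step (b ∷ Rest) {Done} emb with b ∈? Done ++ A
    ... | yes b∈ = record
      { Done′ = Done′ ; φ′ = φ′ ; embedding = embedding ; keeps = keeps
      ; covers = λ { (here refl) → proj₁ (keeps b∈) ; (there x∈) → covers x∈ } }
      where open ExtensionAlong (extend-along step Rest emb)
    ... | no b∉ = record
      { Done′ = Done′ ; φ′ = φ′ ; embedding = embedding
      ; covers = λ { (here refl) → proj₁ (keeps (here refl)) ; (there x∈) → covers x∈ }
      ; keeps  = λ x∈ → proj₁ (keeps (there x∈)) , trans (proj₂ (keeps (there x∈))) (↦-agrees _ b∉ x∈) }
      where open ExtensionAlong (extend-along step Rest (embedding-∷ emb b∉ (proj₂ (step emb b∉))))

    -- Y lists the points the new image w must additionally be placed against.
    module NewPoint (Y : List ℕ) (Q-excludes-Y : ∀ {w} → Q w → w ∈ Y → w ∈ A)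
                    {Done φ} (emb : Embedding Done φ) {b} (b∉ : b ∉ Done ++ A) where
      open Embedding emb

      Dom : List ℕ
      Dom = Done ++ A

      D : List ℕ
      D = L.map φ Dom ++ Y ++ b ∷ []

      b∈D : b ∈ D
      b∈D = ∈-++⁺ʳ (L.map φ Dom) (∈-++⁺ʳ Y (here refl))

      b≢ : ∀ {x} → x ∈ Dom → b ≢ x
      b≢ x∈ b≡x = b∉ (subst (_∈ Dom) (sym b≡x) x∈)

      φ-~ : ∀ {x y} → x ∈ Dom → y ∈ Dom → x ~ y → φ x ~ φ y
      φ-~ _  _  (inj₁ x≡y) = inj₁ (cong φ x≡y)
      φ-~ x∈ y∈ (inj₂ (x≢y , xy , yx)) =
        inj₂ ((λ e → x≢y (injective x∈ y∈ e)) , trans (preserves-E x∈ y∈) xy , trans (preserves-E y∈ x∈) yx)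

      φ-~⁻ : ∀ {x y} → x ∈ Dom → y ∈ Dom → φ x ~ φ y → x ~ y
      φ-~⁻ x∈ y∈ (inj₁ e) = inj₁ (injective x∈ y∈ e)
      φ-~⁻ x∈ y∈ (inj₂ (φx≢φy , xy , yx)) =
        inj₂ ((λ e → φx≢φy (cong φ e)) ,
              trans (sym (preserves-E x∈ y∈)) xy , trans (sym (preserves-E y∈ x∈)) yx)

      PartFor : Part D → Set
      PartFor P = ∀ {x} → x ∈ Dom → (InPart P (φ x) → b ~ x) × (b ~ x → InPart P (φ x))

      partOf-image : ∀ {x₀} (x₀∈ : x₀ ∈ Dom) → b ~ x₀ → PartFor (partOf (φ x₀) (∈-++⁺ˡ (∈-map⁺ φ x₀∈)))
      partOf-image x₀∈ b~x₀ x∈ = (λ φx~φx₀ → ~-trans b~x₀ (~-sym (φ-~⁻ x∈ x₀∈ φx~φx₀))) ,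
                                 (λ b~x → φ-~ x∈ x₀∈ (~-trans (~-sym b~x) b~x₀))

      partOf-b : (∀ {x} → x ∈ Dom → φ x ~ x) → PartFor (partOf b b∈D)
      partOf-b φx~x x∈ = (λ φx~b → ~-sym (~-trans (~-sym (φx~x x∈)) φx~b)) ,
                         (λ b~x → ~-trans (φx~x x∈) (~-sym b~x))

      -- Images of Dom must see w as b sees their preimages; elsewhere dirY decides.
      dir : (ℕ → Bool) → ℕ → Bool
      dir dirY d with any? (λ x → φ x ≟ℕ d) Dom
      ... | yes p = E b (proj₁ (find p))
      ... | no  _ = dirY d

      dir-image : ∀ dirY {x} → x ∈ Dom → dir dirY (φ x) ≡ E b x
      dir-image dirY {x} x∈ with any? (λ y → φ y ≟ℕ φ x) Dom
      ... | yes p = let _ , y∈ , φy≡φx = find p in cong (E b) (injective y∈ x∈ φy≡φx)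
      ... | no ¬p = ⊥-elim (¬p (lose x∈ refl))

      dir-outside : ∀ dirY {y} → y ∉ L.map φ Dom → dir dirY y ≡ dirY y
      dir-outside dirY {y} y∉ with any? (λ x → φ x ≟ℕ y) Dom
      ... | yes p = let _ , x∈ , φx≡y = find p in
                    ⊥-elim (y∉ (subst (_∈ L.map φ Dom) φx≡y (∈-map⁺ φ x∈)))
      ... | no  _ = refl

      Y∖A-outside-image : ∀ {y} → y ∈ Y → y ∉ A → y ∉ L.map φ Dom
      Y∖A-outside-image y∈Y y∉A y∈image with ∈-map⁻ φ y∈image
      ... | x , x∈ , refl with ∈-++⁻ Done x∈
      ...   | inj₁ x∈Done = y∉A (Q-excludes-Y (into-Q x∈Done) y∈Y)
      ...   | inj₂ x∈A    = y∉A (subst (_∈ A) (sym (fixes x∈A)) x∈A)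

      record Result (P : Part D) (dirY : ℕ → Bool) : Set where
        field
          w         : ℕ
          w∉image   : w ∉ L.map φ Dom
          w-edges   : ∀ {x} → x ∈ Dom → E w (φ x) ≡ E b x × E (φ x) w ≡ E x b
          w-Y       : ∀ {y} → y ∈ Y → y ∉ A →
                      (InPart P y → Perp E w y) × (¬ InPart P y → E w y ≡ dirY y × E y w ≡ not (dirY y))
          w-in-part : ∀ {d} → d ∈ D → InPart P d → w ~ d

      newPoint : (P : Part D) → PartFor P → (dirY : ℕ → Bool) → Result P dirY
      newPoint P part-ok dirY = record
        { w = w ; w∉image = λ w∈ → w∉D (∈-++⁺ˡ w∈) ; w-edges = w-edges ; w-Y = w-Y
        ; w-in-part = λ d∈ p → inj₂ (proj₁ (realizes d∈) p) }
        where
        extension = onePointExtension D P (dir dirY)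
        w = proj₁ extension
        w∉D = proj₁ (proj₂ extension)
        realizes = proj₂ (proj₂ extension)
        w-edges : ∀ {x} → x ∈ Dom → E w (φ x) ≡ E b x × E (φ x) w ≡ E x b
        w-edges {x} x∈ with InPart? P (φ x) | realizes (∈-++⁺ˡ (∈-map⁺ φ x∈))
        ... | yes p | inP , _ =
          let _ , wφx , φxw = inP p
              bx , xb = ≢∧~⇒noEdges (b≢ x∈) (proj₁ (part-ok x∈) p)
          in trans wφx (sym bx) , trans φxw (sym xb)
        ... | no ¬p | _ , outP =
          let wφx , φxw = outP ¬p
          in trans wφx (dir-image dirY x∈) ,
             trans φxw (trans (cong not (dir-image dirY x∈))
                              (sym (≢∧≁⇒E-flip (b≢ x∈) (λ b~x → ¬p (proj₂ (part-ok x∈) b~x)))))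
        w-Y : ∀ {y} → y ∈ Y → y ∉ A →
              (InPart P y → Perp E w y) × (¬ InPart P y → E w y ≡ dirY y × E y w ≡ not (dirY y))
        w-Y y∈Y y∉A with dir-outside dirY (Y∖A-outside-image y∈Y y∉A)
                       | realizes (∈-++⁺ʳ (L.map φ Dom) (∈-++⁺ˡ y∈Y))
        ... | dir≡ | inP , outP = inP , λ ¬p → let wy , yw = outP ¬p in trans wy dir≡ , trans yw (cong not dir≡)

      valid : ∀ {P dirY} (r : Result P dirY) → Same (Result.w r) b → Q (Result.w r) →
              ValidImage Dom φ b (Result.w r)
      valid r same q = w∉image , w-edges , same , q
        where open Result r

-- The orientation records on which side of the independence relation the moving points are:
-- true for B (left), false for C (right).
Oriented : (ℕ → ℕ → Set) → Bool → ℕ → ℕ → Set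
Oriented R true  x y = R x y
Oriented R false x y = R y x

-- S expands E; Same x′ x says that x′ may stand in for x as far as the extra structure of S goes.
record Expansion (E : ℕ → ℕ → Bool) : Set₁ where
  field
    {ar}      : List ℕ
    S         : Structure ar
    Same      : ℕ → ℕ → Set
    Same-refl : ∀ x → Same x x
    autS-E    : ∀ (g : Aut S) x y → E (g · x) (g · y) ≡ E x y
    autS-Same : ∀ (g : Aut S) x → Same (g · x) x
    extendS   : ∀ (xs : List ℕ) (φ : ℕ → ℕ) →
                (∀ {x y} → x ∈ xs → y ∈ xs → φ x ≡ φ y → x ≡ y) →
                (∀ {x y} → x ∈ xs → y ∈ xs → E (φ x) (φ y) ≡ E x y) →
                (∀ {x} → x ∈ xs → Same (φ x) x) →
                Σ (Aut S) λ g → ∀ {x} → x ∈ xs → g · x ≡ φ x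

record PairwiseCriterion {E : ℕ → ℕ → Bool} (X : Expansion E) (Base : List ℕ → Set) : Set₁ where
  open Expansion X
  field
    Good            : List ℕ → ℕ → ℕ → Set
    Good-irrefl     : ∀ {A b} → ¬ Good A b b
    Good-weaken     : ∀ {A A′ b c} → Base A → (∀ {x} → x ∈ A → x ∈ A′) → Good A b c → Good A′ b c
    Good-invariant  : ∀ (g : Aut S) {A b c} → Base A → Good A b c → Good (image (proj₁ g) A) (g · b) (g · c)
    Good-stationary : ∀ o (g : Aut S) {A y x} → Base A → Fixes (proj₁ g) A → y ∉ A → x ∉ A →
                      Oriented (Good A) o y x → Oriented (Good A) o (g · y) x →
                      E (g · y) x ≡ E y x × E x (g · y) ≡ E x y

module PairwiseIndependence (n : Card) (E : ℕ → ℕ → Bool) (gen : IsGenericPartiteTournament n E)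
                            (X : Expansion E) {Base : List ℕ → Set} (C : PairwiseCriterion X Base) where
  open Expansion X
  open PairwiseCriterion C
  open IteratedExtension n E gen Same Same-refl public

  IndPair : List ℕ → ℕ → ℕ → Set
  IndPair A b c = b ∈ A ⊎ c ∈ A ⊎ Good A b c

  Ind : IndRel
  Ind A B C = ∀ {b c} → b ∈ B → c ∈ C → IndPair A b c

  IndPair-weaken : ∀ {A A′ b c} → Base A → (∀ {x} → x ∈ A → x ∈ A′) → IndPair A b c → IndPair A′ b c
  IndPair-weaken _    A⊆ (inj₁ b∈A)        = inj₁ (A⊆ b∈A)
  IndPair-weaken _    A⊆ (inj₂ (inj₁ c∈A)) = inj₂ (inj₁ (A⊆ c∈A))
  IndPair-weaken base A⊆ (inj₂ (inj₂ good)) = inj₂ (inj₂ (Good-weaken base A⊆ good))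

  extensional : Extensional S Base Ind
  extensional A A′ B B′ C C′ base A≈ B≈ C≈ ind b∈ c∈ =
    IndPair-weaken base (λ {x} → proj₁ (A≈ x)) (ind (proj₂ (B≈ _) b∈) (proj₂ (C≈ _) c∈))

  invariance : Invariance S Base Ind
  invariance g A B C base ind gb∈ gc∈ with ∈-map⁻ (g ·_) gb∈ | ∈-map⁻ (g ·_) gc∈
  ... | b , b∈ , refl | c , c∈ , refl with ind b∈ c∈
  ...   | inj₁ b∈A         = inj₁ (∈-map⁺ (g ·_) b∈A)
  ...   | inj₂ (inj₁ c∈A)  = inj₂ (inj₁ (∈-map⁺ (g ·_) c∈A))
  ...   | inj₂ (inj₂ good) = inj₂ (inj₂ (Good-invariant g base good))

  monotonicity : Monotonicity S Base Ind
  monotonicity =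
    (λ A B C D base ind → (λ b∈ → ind (∈-++⁺ˡ b∈)) ,
                          (λ d∈ c∈ → IndPair-weaken base ∈-++⁺ˡ (ind (∈-++⁺ʳ B d∈) c∈))) ,
    (λ A B C D base ind → (λ b∈ c∈ → ind b∈ (∈-++⁺ˡ c∈)) ,
                          (λ b∈ d∈ → IndPair-weaken base ∈-++⁺ˡ (ind b∈ (∈-++⁺ʳ C d∈))))

  Oriented-IndPair-self : ∀ o {A y} → Oriented (IndPair A) o y y → y ∈ A
  Oriented-IndPair-self true  (inj₁ y∈A)        = y∈A
  Oriented-IndPair-self true  (inj₂ (inj₁ y∈A)) = y∈A
  Oriented-IndPair-self true  (inj₂ (inj₂ good)) = ⊥-elim (Good-irrefl good)
  Oriented-IndPair-self false (inj₁ y∈A)        = y∈A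
  Oriented-IndPair-self false (inj₂ (inj₁ y∈A)) = y∈A
  Oriented-IndPair-self false (inj₂ (inj₂ good)) = ⊥-elim (Good-irrefl good)

  Oriented-IndPair-Good : ∀ o {A y x} → y ∉ A → x ∉ A → Oriented (IndPair A) o y x → Oriented (Good A) o y x
  Oriented-IndPair-Good true  y∉ x∉ (inj₁ y∈)        = ⊥-elim (y∉ y∈)
  Oriented-IndPair-Good true  y∉ x∉ (inj₂ (inj₁ x∈)) = ⊥-elim (x∉ x∈)
  Oriented-IndPair-Good true  y∉ x∉ (inj₂ (inj₂ good)) = good
  Oriented-IndPair-Good false y∉ x∉ (inj₁ x∈)        = ⊥-elim (x∉ x∈)
  Oriented-IndPair-Good false y∉ x∉ (inj₂ (inj₁ y∈)) = ⊥-elim (y∉ y∈)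
  Oriented-IndPair-Good false y∉ x∉ (inj₂ (inj₂ good)) = good

  -- g moves M to M′ over A, and both are independent from F; h glues g on M to the identity on A ++ F.
  module Glue (o : Bool) {A F M M′ : List ℕ} (base : Base A) (g : Aut S) (g-fixes : Fixes (proj₁ g) A)
              (gM≈M′ : image (proj₁ g) M ≈ₛ M′)
              (ind  : ∀ {y x} → y ∈ M  → x ∈ F → Oriented (IndPair A) o y x)
              (ind′ : ∀ {y x} → y ∈ M′ → x ∈ F → Oriented (IndPair A) o y x) where

    ψ-by : ∀ {x} → Dec (x ∈ A ++ F) → ℕ
    ψ-by {x} (yes _) = x
    ψ-by {x} (no _)  = g · x

    ψ : ℕ → ℕ
    ψ x = ψ-by (x ∈? A ++ F)

    ψ-fixed : ∀ {x} → x ∈ A ++ F → ψ x ≡ x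
    ψ-fixed {x} x∈AF with x ∈? A ++ F
    ... | yes _ = refl
    ... | no x∉AF = ⊥-elim (x∉AF x∈AF)

    ψ-moved : ∀ {x} → x ∉ A ++ F → ψ x ≡ g · x
    ψ-moved {x} x∉AF with x ∈? A ++ F
    ... | yes x∈AF = ⊥-elim (x∉AF x∈AF)
    ... | no _ = refl

    data Kind (x : ℕ) : Set where
      fixed : x ∈ A ++ F → ψ x ≡ x → Kind x
      moved : x ∈ M → x ∉ A ++ F → ψ x ≡ g · x → Kind x

    kind : ∀ {x} → x ∈ (A ++ F) ++ M → Kind x
    kind {x} x∈ with x ∈? A ++ F
    ... | yes x∈AF = fixed x∈AF (ψ-fixed x∈AF)
    ... | no  x∉AF with ∈-++⁻ (A ++ F) x∈
    ...   | inj₁ x∈AF = ⊥-elim (x∉AF x∈AF)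
    ...   | inj₂ x∈M  = moved x∈M x∉AF (ψ-moved x∉AF)

    g-∉A : ∀ {y} → y ∉ A → g · y ∉ A
    g-∉A y∉A gy∈A = y∉A (subst (_∈ A) (·-injective g (g-fixes _ gy∈A)) gy∈A)

    moved-∉A : ∀ {y} → y ∉ A ++ F → y ∉ A
    moved-∉A y∉AF y∈A = y∉AF (∈-++⁺ˡ y∈A)

    g-moved : ∀ {y} → y ∈ M → g · y ∈ M′
    g-moved y∈M = proj₁ (gM≈M′ _) (∈-map⁺ (g ·_) y∈M)

    image-∉AF : ∀ {y} → y ∈ M → y ∉ A ++ F → g · y ∉ A ++ F
    image-∉AF y∈M y∉AF gy∈AF with ∈-++⁻ A gy∈AF
    ... | inj₁ gy∈A = g-∉A (moved-∉A y∉AF) gy∈A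
    ... | inj₂ gy∈F = g-∉A (moved-∉A y∉AF) (Oriented-IndPair-self o (ind′ (g-moved y∈M) gy∈F))

    ψ-injective : ∀ {x y} → x ∈ (A ++ F) ++ M → y ∈ (A ++ F) ++ M → ψ x ≡ ψ y → x ≡ y
    ψ-injective x∈ y∈ e with kind x∈ | kind y∈
    ... | fixed _ p       | fixed _ q       = trans (sym p) (trans e q)
    ... | moved _ _ p     | moved _ _ q     = ·-injective g (trans (sym p) (trans e q))
    ... | fixed x∈AF p    | moved y∈M y∉ q  =
      ⊥-elim (image-∉AF y∈M y∉ (subst (_∈ A ++ F) (trans (sym p) (trans e q)) x∈AF))
    ... | moved x∈M x∉ p  | fixed y∈AF q    =
      ⊥-elim (image-∉AF x∈M x∉ (subst (_∈ A ++ F) (trans (sym q) (trans (sym e) p)) y∈AF))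

    fixed-moved : ∀ {x y} → x ∈ A ++ F → y ∈ M → y ∉ A ++ F → E (g · y) x ≡ E y x × E x (g · y) ≡ E x y
    fixed-moved {x} {y} x∈AF y∈M y∉AF with ∈-++⁻ A x∈AF | x ∈? A
    ... | _ | yes x∈A = trans (cong (E (g · y)) (sym (g-fixes x x∈A))) (autS-E g y x) ,
                        trans (cong (λ v → E v (g · y)) (sym (g-fixes x x∈A))) (autS-E g x y)
    ... | inj₁ x∈A | no x∉A = ⊥-elim (x∉A x∈A)
    ... | inj₂ x∈F | no x∉A =
      Good-stationary o g base g-fixes (moved-∉A y∉AF) x∉A
        (Oriented-IndPair-Good o (moved-∉A y∉AF) x∉A (ind y∈M x∈F))
        (Oriented-IndPair-Good o (g-∉A (moved-∉A y∉AF)) x∉A (ind′ (g-moved y∈M) x∈F))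

    ψ-preserves-E : ∀ {x y} → x ∈ (A ++ F) ++ M → y ∈ (A ++ F) ++ M → E (ψ x) (ψ y) ≡ E x y
    ψ-preserves-E x∈ y∈ with kind x∈ | kind y∈
    ... | fixed _ p      | fixed _ q      = cong₂ E p q
    ... | moved _ _ p    | moved _ _ q    = trans (cong₂ E p q) (autS-E g _ _)
    ... | fixed x∈AF p   | moved y∈M y∉ q = trans (cong₂ E p q) (proj₂ (fixed-moved x∈AF y∈M y∉))
    ... | moved x∈M x∉ p | fixed y∈AF q   = trans (cong₂ E p q) (proj₁ (fixed-moved y∈AF x∈M x∉))

    ψ-preserves-Same : ∀ {x} → x ∈ (A ++ F) ++ M → Same (ψ x) x
    ψ-preserves-Same x∈ with kind x∈
    ... | fixed _ p   = subst (λ v → Same v _) (sym p) (Same-refl _)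
    ... | moved _ _ p = subst (λ v → Same v _) (sym p) (autS-Same g _)

    glued : Σ (Aut S) λ h → Fixes (proj₁ h) (A ++ F) × (∀ y → y ∈ M → h · y ≡ g · y)
    glued = h , (λ x x∈AF → trans (h-ok (∈-++⁺ˡ x∈AF)) (ψ-fixed x∈AF)) , agrees
      where
      extension = extendS ((A ++ F) ++ M) ψ ψ-injective ψ-preserves-E ψ-preserves-Same
      h = proj₁ extension
      h-ok = proj₂ extension
      agrees : ∀ y → y ∈ M → h · y ≡ g · y
      agrees y y∈M with kind (∈-++⁺ʳ (A ++ F) y∈M)
      ... | moved _ _ q = trans (h-ok (∈-++⁺ʳ (A ++ F) y∈M)) q
      ... | fixed y∈AF q with ∈-++⁻ A y∈AF
      ...   | inj₁ y∈A = trans (h-ok (∈-++⁺ʳ (A ++ F) y∈M)) (trans q (sym (g-fixes y y∈A)))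
      ...   | inj₂ y∈F = trans (h-ok (∈-++⁺ʳ (A ++ F) y∈M))
                           (trans q (sym (g-fixes y (Oriented-IndPair-self o (ind y∈M y∈F)))))

  stationarity : Stationarity S Base Ind
  stationarity =
    (λ A B B′ C g base ind ind′ g-fixes gB≈B′ → Glue.glued true  base g g-fixes gB≈B′ ind ind′) ,
    (λ A B C C′ g base ind ind′ g-fixes gC≈C′ →
       Glue.glued false base g g-fixes gC≈C′ (λ c∈ b∈ → ind b∈ c∈) (λ c∈ b∈ → ind′ b∈ c∈))

  IndependentOf : Bool → List ℕ → List ℕ → ℕ → Set
  IndependentOf o A Y w = ∀ {y} → y ∈ Y → y ∈ A ⊎ Oriented (Good A) o w y

  IndependentOf-excludes : ∀ o {A Y w} → IndependentOf o A Y w → w ∈ Y → w ∈ A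
  IndependentOf-excludes true  ind w∈Y with ind w∈Y
  ... | inj₁ w∈A  = w∈A
  ... | inj₂ good = ⊥-elim (Good-irrefl good)
  IndependentOf-excludes false ind w∈Y with ind w∈Y
  ... | inj₁ w∈A  = w∈A
  ... | inj₂ good = ⊥-elim (Good-irrefl good)

  IndependentOf-intro : ∀ o {A Y w} → (∀ {y} → y ∈ Y → y ∉ A → Oriented (Good A) o w y) → IndependentOf o A Y w
  IndependentOf-intro o {A} good {y} y∈Y with y ∈? A
  ... | yes y∈A = inj₁ y∈A
  ... | no y∉A  = inj₂ (good y∈Y y∉A)

  realize : ∀ {A Q} → Over.OnePointStep A Q → ∀ B →
    Σ (Aut S) λ g → Fixes (proj₁ g) A × (∀ {b} → b ∈ B → b ∉ A → Q (g · b))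
  realize {A} {Q} step B = g , (λ a a∈A → trans (g-ok (∈-++⁺ʳ Done′ a∈A)) (fixes a∈A)) , into
    where
    open Over A Q
    open ExtensionAlong (extend-along step B identity)
    open Embedding embedding
    extension = extendS (Done′ ++ A) φ′ injective preserves-E preserves-Same
    g = proj₁ extension
    g-ok = proj₂ extension
    into : ∀ {b} → b ∈ B → b ∉ A → Q (g · b)
    into b∈B b∉A with ∈-++⁻ Done′ (covers b∈B)
    ... | inj₁ b∈Done′ = subst Q (sym (g-ok (∈-++⁺ˡ b∈Done′))) (into-Q b∈Done′)
    ... | inj₂ b∈A     = ⊥-elim (b∉A b∈A)

  OnePointSteps : Set
  OnePointSteps = ∀ o {A} Y → Base A → Over.OnePointStep A (IndependentOf o A Y)

  existence : OnePointSteps → Existence S Base Ind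
  existence steps A B C base =
    (g , g-fixes , λ gb∈ c∈ → left gb∈ c∈) , (h , h-fixes , λ b∈ hc∈ → right b∈ hc∈)
    where
    moveB = realize (steps true C base) B
    g = proj₁ moveB
    g-fixes = proj₁ (proj₂ moveB)
    left : ∀ {b′ c} → b′ ∈ image (proj₁ g) B → c ∈ C → IndPair A b′ c
    left gb∈ c∈ with ∈-map⁻ (g ·_) gb∈
    ... | b , b∈B , refl with b ∈? A
    ...   | yes b∈A = inj₁ (subst (_∈ A) (sym (g-fixes b b∈A)) b∈A)
    ...   | no b∉A with proj₂ (proj₂ moveB) b∈B b∉A c∈
    ...     | inj₁ c∈A  = inj₂ (inj₁ c∈A)
    ...     | inj₂ good = inj₂ (inj₂ good)
    moveC = realize (steps false B base) C
    h = proj₁ moveC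
    h-fixes = proj₁ (proj₂ moveC)
    right : ∀ {b c′} → b ∈ B → c′ ∈ image (proj₁ h) C → IndPair A b c′
    right b∈ hc∈ with ∈-map⁻ (h ·_) hc∈
    ... | c , c∈C , refl with c ∈? A
    ...   | yes c∈A = inj₂ (inj₁ (subst (_∈ A) (sym (h-fixes c c∈A)) c∈A))
    ...   | no c∉A with proj₂ (proj₂ moveC) c∈C c∉A b∈
    ...     | inj₁ b∈A  = inj₁ b∈A
    ...     | inj₂ good = inj₂ (inj₂ good)

  symmetric : (∀ {A b c} → Good A b c → Good A c b) → Symmetric S Base Ind
  symmetric Good-sym A B C _ ind c∈ b∈ with ind b∈ c∈
  ... | inj₁ b∈A         = inj₂ (inj₁ b∈A)
  ... | inj₂ (inj₁ c∈A)  = inj₁ c∈A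
  ... | inj₂ (inj₂ good) = inj₂ (inj₂ (Good-sym good))

  isSWIR : OnePointSteps → IsSWIRwrt S Base Ind
  isSWIR steps = extensional , invariance , existence steps , stationarity , monotonicity

graphExpansion : ∀ E → Ultrahomogeneous (graphStr E) → Expansion E
graphExpansion E uh = record
  { S = graphStr E ; Same = λ _ _ → ⊤ ; Same-refl = λ _ → tt ; autS-E = aut-E ; autS-Same = λ _ _ → tt
  ; extendS = λ xs φ inj pres _ → extend-List xs φ inj pres }
  where open Homogeneity E uh

module GraphFacts (n : Card) (E : ℕ → ℕ → Bool) (gen : IsGenericPartiteTournament n E) where
  open PartiteFacts n E (proj₁ gen)
  open Homogeneity E (proj₂ (proj₂ gen))

  Perp-sym : ∀ {x y} → Perp E x y → Perp E y x
  Perp-sym (x≢y , xy , yx) = (λ y≡x → x≢y (sym y≡x)) , yx , xy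

  aut-~ : ∀ (g : Aut (graphStr E)) {x y} → x ~ y → g · x ~ g · y
  aut-~ g (inj₁ x≡y) = inj₁ (cong (g ·_) x≡y)
  aut-~ g {x} {y} (inj₂ (x≢y , xy , yx)) =
    inj₂ ((λ e → x≢y (·-injective g e)) , trans (aut-E g x y) xy , trans (aut-E g y x) yx)

  aut-~⁻ : ∀ (g : Aut (graphStr E)) {x y} → g · x ~ g · y → x ~ y
  aut-~⁻ g (inj₁ e) = inj₁ (·-injective g e)
  aut-~⁻ g {x} {y} (inj₂ (gx≢gy , xy , yx)) =
    inj₂ ((λ e → gx≢gy (cong (g ·_) e)) , trans (sym (aut-E g x y)) xy , trans (sym (aut-E g y x)) yx)

  fixed-~ : ∀ (g : Aut (graphStr E)) {A a x} → Fixes (proj₁ g) A → a ∈ A → x ~ a → g · x ~ a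
  fixed-~ g g-fixes a∈ x~a = subst (_ ~_) (g-fixes _ a∈) (aut-~ g x~a)

  fixed-~⁻ : ∀ (g : Aut (graphStr E)) {A a x} → Fixes (proj₁ g) A → a ∈ A → g · x ~ a → x ~ a
  fixed-~⁻ g g-fixes a∈ gx~a = aut-~⁻ g (subst (_ ~_) (sym (g-fixes _ a∈)) gx~a)

  Edge : Bool → ℕ → ℕ → Set
  Edge o = Oriented (λ u v → E u v ≡ true) o

  Edge⇒≁ : ∀ o {y x} → Edge o y x → ¬ (y ~ x)
  Edge⇒≁ true  e y~x = E⇒≁ e y~x
  Edge⇒≁ false e y~x = E⇒≁ e (~-sym y~x)

  Edge-from-dir : ∀ o {w y} → E w y ≡ o → E y w ≡ not o → Edge o w y
  Edge-from-dir true  wy _  = wy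
  Edge-from-dir false _  yw = yw

  edges-agree : ∀ o {x y y′} → Edge o y x ⊎ Perp E y x → Edge o y′ x ⊎ Perp E y′ x →
    (Perp E y x ⊎ Perp E y′ x → y ~ y′) → E y′ x ≡ E y x × E x y′ ≡ E x y
  edges-agree true  (inj₁ e) (inj₁ e′) _ = trans e′ (sym e) , trans (E-asym _ _ e′) (sym (E-asym _ _ e))
  edges-agree false (inj₁ e) (inj₁ e′) _ = trans (E-asym _ _ e′) (sym (E-asym _ _ e)) , trans e′ (sym e)
  edges-agree o (inj₂ (_ , yx , xy)) (inj₂ (_ , y′x , xy′)) _ = trans y′x (sym yx) , trans xy′ (sym xy)
  edges-agree o (inj₁ e) (inj₂ p′) same = ⊥-elim (Edge⇒≁ o e (~-trans (same (inj₂ p′)) (inj₂ p′)))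
  edges-agree o (inj₂ p) (inj₁ e′) same = ⊥-elim (Edge⇒≁ o e′ (~-trans (~-sym (same (inj₁ p))) (inj₂ p)))

  aut-Perp : ∀ (g : Aut (graphStr E)) {x y} → Perp E x y → Perp E (g · x) (g · y)
  aut-Perp g {x} {y} (x≢y , xy , yx) =
    (λ e → x≢y (·-injective g e)) , trans (aut-E g x y) xy , trans (aut-E g y x) yx

module OmegaSWIR (E : ℕ → ℕ → Bool) (gen : IsGenericPartiteTournament ω E) where
  open PartiteFacts ω E (proj₁ gen)
  open Homogeneity E (proj₂ (proj₂ gen))
  open GraphFacts ω E gen

  Meets : List ℕ → ℕ → Set
  Meets A b = ∃ λ a → a ∈ A × b ~ a

  Meets-~ : ∀ {A u v} → u ~ v → Meets A u → Meets A v
  Meets-~ u~v (a , a∈ , u~a) = a , a∈ , ~-trans (~-sym u~v) u~a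

  Good : List ℕ → ℕ → ℕ → Set
  Good A b c = E b c ≡ true ⊎ (Perp E b c × Meets A b)

  Good-edge : ∀ o {A w y} → Edge o w y → Oriented (Good A) o w y
  Good-edge true  e = inj₁ e
  Good-edge false e = inj₁ e

  Good-perp : ∀ o {A w y} → Perp E w y → Meets A w → Oriented (Good A) o w y
  Good-perp true  p m = inj₂ (p , m)
  Good-perp false p m = inj₂ (Perp-sym p , Meets-~ (inj₂ p) m)

  Good⇒Edge⊎Perp : ∀ o {A y x} → Oriented (Good A) o y x → Edge o y x ⊎ Perp E y x
  Good⇒Edge⊎Perp true  (inj₁ e)       = inj₁ e
  Good⇒Edge⊎Perp true  (inj₂ (p , _)) = inj₂ p
  Good⇒Edge⊎Perp false (inj₁ e)       = inj₁ e
  Good⇒Edge⊎Perp false (inj₂ (p , _)) = inj₂ (Perp-sym p)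

  Good-~⇒Meets : ∀ o {A u v} → u ~ v → Oriented (Good A) o u v → Meets A u
  Good-~⇒Meets true  u~v (inj₁ e)       = ⊥-elim (E⇒≁ e u~v)
  Good-~⇒Meets true  u~v (inj₂ (_ , m)) = m
  Good-~⇒Meets false u~v (inj₁ e)       = ⊥-elim (E⇒≁ e (~-sym u~v))
  Good-~⇒Meets false u~v (inj₂ (_ , m)) = Meets-~ (~-sym u~v) m

  criterion : PairwiseCriterion (graphExpansion E (proj₂ (proj₂ gen))) AnyBase
  criterion = record
    { Good            = Good
    ; Good-irrefl     = λ { (inj₁ e) → E⇒≢ e refl ; (inj₂ ((b≢b , _) , _)) → b≢b refl }
    ; Good-weaken     = λ { _ _  (inj₁ e) → inj₁ e
                          ; _ A⊆ (inj₂ (p , a , a∈ , b~a)) → inj₂ (p , a , A⊆ a∈ , b~a) }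
    ; Good-invariant  = invariant
    ; Good-stationary = stationary
    }
    where
    invariant : ∀ (g : Aut (graphStr E)) {A b c} → AnyBase A → Good A b c →
      Good (image (proj₁ g) A) (g · b) (g · c)
    invariant g _ (inj₁ e) = inj₁ (trans (aut-E g _ _) e)
    invariant g _ (inj₂ (p , a , a∈ , b~a)) = inj₂ (aut-Perp g p , g · a , ∈-map⁺ (g ·_) a∈ , aut-~ g b~a)
    stationary : ∀ o (g : Aut (graphStr E)) {A y x} → AnyBase A → Fixes (proj₁ g) A → y ∉ A → x ∉ A →
      Oriented (Good A) o y x → Oriented (Good A) o (g · y) x → E (g · y) x ≡ E y x × E x (g · y) ≡ E x y
    stationary o g {A} {y} {x} _ g-fixes _ _ good good′ =
      edges-agree o (Good⇒Edge⊎Perp o good) (Good⇒Edge⊎Perp o good′) same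
      where
      same : Perp E y x ⊎ Perp E (g · y) x → y ~ g · y
      same (inj₁ p) with a , a∈ , y~a ← Good-~⇒Meets o (inj₂ p) good =
        ~-trans y~a (~-sym (fixed-~ g g-fixes a∈ y~a))
      same (inj₂ p′) with a , a∈ , gy~a ← Good-~⇒Meets o (inj₂ p′) good′ =
        ~-trans (fixed-~⁻ g g-fixes a∈ gy~a) (~-sym gy~a)

  open PairwiseIndependence ω E gen (graphExpansion E (proj₂ (proj₂ gen))) criterion
    using (Ind; isSWIR; OnePointSteps; IndependentOf; IndependentOf-intro; IndependentOf-excludes;
           module Over; partOf; newPart)

  steps : OnePointSteps
  steps o {A} Y _ {Done} {φ} emb {b} b∉ with any? (b ~?_) (Done ++ A)
  ... | yes found = w , valid r tt (IndependentOf-intro o Y-good)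
    where
    open Over A (IndependentOf o A Y)
    open Embedding emb
    open NewPoint Y (IndependentOf-excludes o) emb b∉
    x₀ = proj₁ (find found)
    x₀∈ = proj₁ (proj₂ (find found))
    φx₀∈D = ∈-++⁺ˡ (∈-map⁺ φ x₀∈)
    r = newPoint (partOf (φ x₀) φx₀∈D) (partOf-image x₀∈ (proj₂ (proj₂ (find found)))) (λ _ → o)
    open Result r
    φx₀-meets : ∀ {y} → y ∈ Y → y ∉ A → y ~ φ x₀ → Meets A (φ x₀)
    φx₀-meets y∈Y y∉A y~φx₀ with ∈-++⁻ Done x₀∈
    ... | inj₂ x₀∈A    = x₀ , x₀∈A , inj₁ (fixes x₀∈A)
    ... | inj₁ x₀∈Done with into-Q x₀∈Done y∈Y
    ...   | inj₁ y∈A  = ⊥-elim (y∉A y∈A)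
    ...   | inj₂ good = Good-~⇒Meets o (~-sym y~φx₀) good
    Y-good : ∀ {y} → y ∈ Y → y ∉ A → Oriented (Good A) o w y
    Y-good {y} y∈Y y∉A with y ~? φ x₀
    ... | yes y~φx₀ = Good-perp o (proj₁ (w-Y y∈Y y∉A) y~φx₀)
                        (Meets-~ (~-sym (w-in-part φx₀∈D (inj₁ refl))) (φx₀-meets y∈Y y∉A y~φx₀))
    ... | no y≁φx₀ = let wy , yw = proj₂ (w-Y y∈Y y∉A) y≁φx₀ in Good-edge o (Edge-from-dir o wy yw)
  ... | no none = w , valid r tt (IndependentOf-intro o Y-good)
    where
    open Over A (IndependentOf o A Y)
    open NewPoint Y (IndependentOf-excludes o) emb b∉
    r = newPoint (newPart refl) (λ x∈ → (λ ()) , λ b~x → none (lose x∈ b~x)) (λ _ → o)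
    open Result r
    Y-good : ∀ {y} → y ∈ Y → y ∉ A → Oriented (Good A) o w y
    Y-good y∈Y y∉A = let wy , yw = proj₂ (w-Y y∈Y y∉A) (λ ()) in Good-edge o (Edge-from-dir o wy yw)

  hasSWIR : HasSWIR (graphStr E)
  hasSWIR = Ind , isSWIR steps

module BipartiteLocalSWIR (E : ℕ → ℕ → Bool) (gen : IsGenericPartiteTournament (fin 2) E) where
  open PartiteFacts (fin 2) E (proj₁ gen)
  open Homogeneity E (proj₂ (proj₂ gen))
  open GraphFacts (fin 2) E gen

  two-parts : ∀ {x y z} → ¬ (x ~ y) → ¬ (y ~ z) → x ~ z
  two-parts {x} {y} {z} x≁y y≁z with x ~? z
  ... | yes x~z = x~z
  ... | no x≁z = ⊥-elim (no-large-antichain refl (x ∷ y ∷ z ∷ [])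
                   (distinct₃ (λ e → x≁y (inj₁ e)) (λ e → x≁z (inj₁ e)) (λ e → y≁z (inj₁ e))) antichain)
    where
    antichain : ∀ i j → i ≢ j → ¬ (lookup (x ∷ y ∷ z ∷ []) i ~ lookup (x ∷ y ∷ z ∷ []) j)
    antichain fzero               fzero               i≢j _ = i≢j refl
    antichain fzero               (fsuc fzero)        _   p = x≁y p
    antichain fzero               (fsuc (fsuc fzero)) _   p = x≁z p
    antichain (fsuc fzero)        fzero               _   p = x≁y (~-sym p)
    antichain (fsuc fzero)        (fsuc fzero)        i≢j _ = i≢j refl
    antichain (fsuc fzero)        (fsuc (fsuc fzero)) _   p = y≁z p
    antichain (fsuc (fsuc fzero)) fzero               _   p = x≁z (~-sym p)
    antichain (fsuc (fsuc fzero)) (fsuc fzero)        _   p = y≁z (~-sym p)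
    antichain (fsuc (fsuc fzero)) (fsuc (fsuc fzero)) i≢j _ = i≢j refl

  same-side : ∀ {a x x′} → (x ~ a → x′ ~ a) → (x′ ~ a → x ~ a) → x ~ x′
  same-side {a} {x} {x′} to from with x ~? a
  ... | yes x~a = ~-trans x~a (~-sym (to x~a))
  ... | no x≁a  = two-parts x≁a (λ a~x′ → x≁a (from (~-sym a~x′)))

  NonEmpty-∈ : ∀ {A} → NonEmptyBase A → ∃ (_∈ A)
  NonEmpty-∈ {[]}    A≢[] = ⊥-elim (A≢[] refl)
  NonEmpty-∈ {a ∷ _} _    = a , here refl

  Good : List ℕ → ℕ → ℕ → Set
  Good A b c = E b c ≡ true ⊎ Perp E b c

  Good-Oriented : ∀ o {A w y} → Edge o w y ⊎ Perp E w y → Oriented (Good A) o w y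
  Good-Oriented true  (inj₁ e) = inj₁ e
  Good-Oriented true  (inj₂ p) = inj₂ p
  Good-Oriented false (inj₁ e) = inj₁ e
  Good-Oriented false (inj₂ p) = inj₂ (Perp-sym p)

  Good⇒Edge⊎Perp : ∀ o {A y x} → Oriented (Good A) o y x → Edge o y x ⊎ Perp E y x
  Good⇒Edge⊎Perp true  good     = good
  Good⇒Edge⊎Perp false (inj₁ e) = inj₁ e
  Good⇒Edge⊎Perp false (inj₂ p) = inj₂ (Perp-sym p)

  criterion : PairwiseCriterion (graphExpansion E (proj₂ (proj₂ gen))) NonEmptyBase
  criterion = record
    { Good            = Good
    ; Good-irrefl     = λ { (inj₁ e) → E⇒≢ e refl ; (inj₂ (b≢b , _)) → b≢b refl }
    ; Good-weaken     = λ _ _ good → good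
    ; Good-invariant  = λ { g _ (inj₁ e) → inj₁ (trans (aut-E g _ _) e) ; g _ (inj₂ p) → inj₂ (aut-Perp g p) }
    ; Good-stationary = stationary
    }
    where
    stationary : ∀ o (g : Aut (graphStr E)) {A y x} → NonEmptyBase A → Fixes (proj₁ g) A → y ∉ A → x ∉ A →
      Oriented (Good A) o y x → Oriented (Good A) o (g · y) x → E (g · y) x ≡ E y x × E x (g · y) ≡ E x y
    stationary o g {A} A≢[] g-fixes _ _ good good′ =
      edges-agree o (Good⇒Edge⊎Perp o {A} good) (Good⇒Edge⊎Perp o {A} good′) λ _ →
        same-side (fixed-~ g g-fixes a∈) (fixed-~⁻ g g-fixes a∈)
      where a∈ = proj₂ (NonEmpty-∈ A≢[])

  open PairwiseIndependence (fin 2) E gen (graphExpansion E (proj₂ (proj₂ gen))) criterion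
    using (Ind; isSWIR; OnePointSteps; IndependentOf; IndependentOf-intro; IndependentOf-excludes; module Over; partOf)

  -- The new point can always be put in the part of b, since φ keeps every point in its part.
  steps : OnePointSteps
  steps o {A} Y A≢[] {Done} {φ} emb {b} b∉ = w , valid r tt (IndependentOf-intro o Y-good)
    where
    open Over A (IndependentOf o A Y)
    open Embedding emb
    open NewPoint Y (IndependentOf-excludes o) emb b∉
    a = proj₁ (NonEmpty-∈ A≢[])
    a∈Dom = ∈-++⁺ʳ Done (proj₂ (NonEmpty-∈ A≢[]))
    φa≡a = fixes (proj₂ (NonEmpty-∈ A≢[]))
    φx~x : ∀ {x} → x ∈ Dom → φ x ~ x
    φx~x x∈ = ~-sym (same-side (λ x~a → subst (_ ~_) φa≡a (φ-~ x∈ a∈Dom x~a))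
                               (λ φx~a → φ-~⁻ x∈ a∈Dom (subst (_ ~_) (sym φa≡a) φx~a)))
    r = newPoint (partOf b b∈D) (partOf-b φx~x) (λ _ → o)
    open Result r
    Y-good : ∀ {y} → y ∈ Y → y ∉ A → Oriented (Good A) o w y
    Y-good {y} y∈Y y∉A with y ~? b
    ... | yes y~b = Good-Oriented o {A} (inj₂ (proj₁ (w-Y y∈Y y∉A) y~b))
    ... | no y≁b  = let wy , yw = proj₂ (w-Y y∈Y y∉A) y≁b in Good-Oriented o {A} (inj₁ (Edge-from-dir o wy yw))

  hasLocalSWIR : HasLocalSWIR (graphStr E)
  hasLocalSWIR = Ind , isSWIR steps

-- m unary predicates, the i-th interpreted by P · i; symbol and singleton address the i-th one.
unaryLanguage : ℕ → List ℕ
unaryLanguage m = L.replicate m 1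

unary : ∀ m → (ℕ → Fin m → Bool) →
  (r : Fin (length (unaryLanguage m))) → Vec ℕ (L.lookup (unaryLanguage m) r) → Bool
unary (suc m) P fzero    (x ∷ []) = P x fzero
unary (suc m) P (fsuc r) v        = unary m (λ x i → P x (fsuc i)) r v

unary-map : ∀ m P (h : ℕ → ℕ) → (∀ x i → P (h x) i ≡ P x i) → ∀ r v → unary m P r (V.map h v) ≡ unary m P r v
unary-map (suc m) P h h-ok fzero    (x ∷ []) = h-ok x fzero
unary-map (suc m) P h h-ok (fsuc r) v        = unary-map m (λ x i → P x (fsuc i)) h (λ x i → h-ok x (fsuc i)) r v

symbol : ∀ m → Fin m → Fin (length (unaryLanguage m))
symbol (suc m) fzero    = fzero
symbol (suc m) (fsuc i) = fsuc (symbol m i)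

singleton : ∀ m (i : Fin m) {X : Set} → X → Vec X (L.lookup (unaryLanguage m) (symbol m i))
singleton (suc m) fzero    x = x ∷ []
singleton (suc m) (fsuc i) x = singleton m i x

map-singleton : ∀ m (i : Fin m) {X Y : Set} (f : X → Y) x → V.map f (singleton m i x) ≡ singleton m i (f x)
map-singleton (suc m) fzero    f x = refl
map-singleton (suc m) (fsuc i) f x = map-singleton m i f x

unary-singleton : ∀ m P (i : Fin m) x → unary m P (symbol m i) (singleton m i x) ≡ P x i
unary-singleton (suc m) P fzero    x = refl
unary-singleton (suc m) P (fsuc i) x = unary-singleton m (λ x i → P x (fsuc i)) i x

does-≟⇒≡ : ∀ {m} {i j : Fin m} → does (i Fin.≟ j) ≡ true → i ≡ j
does-≟⇒≡ {i = i} {j} h with i Fin.≟ j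
... | yes i≡j = i≡j

module LabelledExpansion (m : ℕ) (E : ℕ → ℕ → Bool) (gen : IsGenericPartiteTournament (fin m) E) where
  open Transversal m E gen
  open GraphFacts (fin m) E gen

  label-spec : ∀ x → ∃ λ i → x ~ t i
  label-spec x with Fin.any? (λ i → x ~? t i)
  ... | yes found = found
  ... | no none   = ⊥-elim (t-meets-every-part x λ i x~ti → none (i , x~ti))

  label : ℕ → Fin m
  label x = proj₁ (label-spec x)

  ~⇒label≡ : ∀ {x y} → x ~ y → label x ≡ label y
  ~⇒label≡ {x} {y} x~y with label x Fin.≟ label y
  ... | yes same = same
  ... | no differ = ⊥-elim (t≁ differ (~-trans (~-sym (proj₂ (label-spec x))) (~-trans x~y (proj₂ (label-spec y)))))

  label≡⇒~ : ∀ {x y} → label x ≡ label y → x ~ y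
  label≡⇒~ {x} {y} same =
    ~-trans (proj₂ (label-spec x)) (subst (λ i → t i ~ y) (sym same) (~-sym (proj₂ (label-spec y))))

  hasLabel : ℕ → Fin m → Bool
  hasLabel x i = does (label x Fin.≟ i)

  hasLabel⇒label≡ : ∀ {x y} → (∀ i → hasLabel x i ≡ hasLabel y i) → label x ≡ label y
  hasLabel⇒label≡ {x} same = sym (does-≟⇒≡ (trans (sym (same (label x))) (dec-true (label x Fin.≟ label x) refl)))

  SE : Structure (2 L.∷ unaryLanguage m)
  SE = expand E (unaryLanguage m) (mkStr (unary m hasLabel))

  SE-label : ∀ {x y} →
    (∀ i → rel SE (fsuc (symbol m i)) (singleton m i x) ≡ rel SE (fsuc (symbol m i)) (singleton m i y)) →
    label x ≡ label y
  SE-label {x} {y} same = hasLabel⇒label≡ λ i →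
    trans (sym (unary-singleton m hasLabel i x)) (trans (same i) (unary-singleton m hasLabel i y))

  autSE-E : ∀ (g : Aut SE) x y → E (g · x) (g · y) ≡ E x y
  autSE-E g x y = proj₂ g fzero (x ∷ y ∷ [])

  autSE-label : ∀ (g : Aut SE) x → label (g · x) ≡ label x
  autSE-label g x = SE-label λ i →
    trans (cong (unary m hasLabel (symbol m i)) (sym (map-singleton m i (g ·_) x)))
          (proj₂ g (fsuc (symbol m i)) (singleton m i x))

  aut⇒autSE : (g : Aut (graphStr E)) → (∀ x → label (g · x) ≡ label x) → IsAut SE (proj₁ g)
  aut⇒autSE g g-label fzero    (x ∷ y ∷ []) = aut-E g x y
  aut⇒autSE g g-label (fsuc r) v            =
    unary-map m hasLabel (g ·_) (λ x i → cong (λ l → does (l Fin.≟ i)) (g-label x)) r v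

  module LabelPreserving = IteratedExtension (fin m) E gen (λ x y → label x ≡ label y) (λ _ → refl)
  open LabelPreserving using (partOf)

  -- The new point is put in the part of b and directed by labels towards Y; this keeps labels.
  module LabelledStep {A Q} (Y : List ℕ) (Q-excludes-Y : ∀ {w} → Q w → w ∈ Y → w ∈ A)
                      {Done φ} (emb : LabelPreserving.Over.Embedding A Q Done φ) {b} (b∉ : b ∉ Done ++ A) where
    open LabelPreserving.Over A Q
    open Embedding emb
    open NewPoint Y Q-excludes-Y emb b∉

    result : Result (partOf b b∈D) (λ y → <-tournament (label b) (label y))
    result = newPoint (partOf b b∈D) (partOf-b λ x∈ → label≡⇒~ (preserves-Same x∈))
                      (λ y → <-tournament (label b) (label y))
    open Result result public

    w-label : label w ≡ label b
    w-label = ~⇒label≡ (w-in-part b∈D (inj₁ refl))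

    extension-by-w : Q w → ∃ (ValidImage Dom φ b)
    extension-by-w q = w , valid result w-label q

  extendSE : ∀ (xs : List ℕ) (φ : ℕ → ℕ) →
    (∀ {x y} → x ∈ xs → y ∈ xs → φ x ≡ φ y → x ≡ y) →
    (∀ {x y} → x ∈ xs → y ∈ xs → E (φ x) (φ y) ≡ E x y) →
    (∀ {x} → x ∈ xs → label (φ x) ≡ label x) →
    Σ (Aut SE) λ g → ∀ {x} → x ∈ xs → g · x ≡ φ x
  extendSE xs φ inj pres same =
    (proj₁ g , aut⇒autSE g g-label) , λ x∈ → trans (g-ok (covers (∈-++⁺ˡ x∈))) (proj₂ (keeps (∈-++⁺ˡ x∈)))
    where
    open LabelPreserving.Over [] (λ _ → ⊤)
    given : Embedding xs φ
    given = record { fixes = λ () ; injective = λ x∈ y∈ → inj (from x∈) (from y∈)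
                   ; preserves-E = λ x∈ y∈ → pres (from x∈) (from y∈)
                   ; preserves-Same = λ x∈ → same (from x∈)
                   ; into-Q = λ _ → tt }
      where
      from : ∀ {x} → x ∈ xs ++ [] → x ∈ xs
      from x∈ with ∈-++⁻ xs x∈
      ... | inj₁ p = p
    step : OnePointStep
    step emb b∉ = LabelledStep.extension-by-w [] (λ _ ()) emb b∉ tt
    -- Covering the transversal t forces the extension to respect labels everywhere.
    open ExtensionAlong (extend-along step (xs ++ L.map t (L.allFin m)) given)
    open Embedding embedding
    extension = extend-List (Done′ ++ []) φ′ injective preserves-E
    g = proj₁ extension
    g-ok = proj₂ extension
    g-label : ∀ x → label (g · x) ≡ label x
    g-label x = trans (~⇒label≡ (aut-~ g (proj₂ (label-spec x))))
                  (trans (cong label (g-ok t∈))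
                         (trans (preserves-Same t∈) (~⇒label≡ (~-sym (proj₂ (label-spec x))))))
      where
      t∈ = covers (∈-++⁺ʳ xs (∈-map⁺ t (∈-allFin (label x))))

  SE-ultrahomogeneous : Ultrahomogeneous SE
  SE-ultrahomogeneous k xs ys (resp , reflect , rels) = g , λ i → trans (g-ok (∈-tabulate⁺ i)) (φ-xs i)
    where
    φ : ℕ → ℕ
    φ x with Fin.any? (λ j → lookup xs j ≟ℕ x)
    ... | yes (j , _) = lookup ys j
    ... | no  _       = x
    φ-xs : ∀ i → φ (lookup xs i) ≡ lookup ys i
    φ-xs i with Fin.any? (λ j → lookup xs j ≟ℕ lookup xs i)
    ... | yes (j , xj≡xi) = resp j i xj≡xi
    ... | no none         = ⊥-elim (none (i , refl))
    dom = L.tabulate (lookup xs)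
    φ-dom : ∀ {x} (x∈ : x ∈ dom) → φ x ≡ lookup ys (proj₁ (∈-tabulate⁻ x∈))
    φ-dom x∈ = trans (cong φ (proj₂ (∈-tabulate⁻ x∈))) (φ-xs _)
    inj : ∀ {x y} → x ∈ dom → y ∈ dom → φ x ≡ φ y → x ≡ y
    inj x∈ y∈ e = trans (proj₂ (∈-tabulate⁻ x∈))
      (trans (reflect _ _ (trans (sym (φ-dom x∈)) (trans e (φ-dom y∈)))) (sym (proj₂ (∈-tabulate⁻ y∈))))
    pres : ∀ {x y} → x ∈ dom → y ∈ dom → E (φ x) (φ y) ≡ E x y
    pres x∈ y∈ = trans (cong₂ E (φ-dom x∈) (φ-dom y∈))
      (trans (sym (rels fzero (proj₁ (∈-tabulate⁻ x∈) ∷ proj₁ (∈-tabulate⁻ y∈) ∷ [])))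
             (sym (cong₂ E (proj₂ (∈-tabulate⁻ x∈)) (proj₂ (∈-tabulate⁻ y∈)))))
    ys-label : ∀ i → label (lookup ys i) ≡ label (lookup xs i)
    ys-label i = SE-label λ l →
      trans (cong (unary m hasLabel (symbol m l)) (sym (map-singleton m l (lookup ys) i)))
        (trans (sym (rels (fsuc (symbol m l)) (singleton m l i)))
               (cong (unary m hasLabel (symbol m l)) (map-singleton m l (lookup xs) i)))
    same : ∀ {x} → x ∈ dom → label (φ x) ≡ label x
    same x∈ = trans (cong label (φ-dom x∈)) (trans (ys-label _) (cong label (sym (proj₂ (∈-tabulate⁻ x∈)))))
    extension = extendSE dom φ inj pres same
    g = proj₁ extension
    g-ok = proj₂ extension

  labelExpansion : Expansion E
  labelExpansion = record
    { S = SE ; Same = λ x y → label x ≡ label y ; Same-refl = λ _ → refl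
    ; autS-E = autSE-E ; autS-Same = autSE-label ; extendS = extendSE }

  LabelOrdered : ℕ → ℕ → Set
  LabelOrdered b c = b ≢ c × E b c ≡ <-tournament (label b) (label c) × E c b ≡ <-tournament (label c) (label b)

  LabelOrdered-sym : ∀ {b c} → LabelOrdered b c → LabelOrdered c b
  LabelOrdered-sym (b≢c , bc , cb) = (λ c≡b → b≢c (sym c≡b)) , cb , bc

  Oriented⇒LabelOrdered : ∀ o {y x} → Oriented (λ b c → LabelOrdered b c) o y x → LabelOrdered y x
  Oriented⇒LabelOrdered true  p = p
  Oriented⇒LabelOrdered false p = LabelOrdered-sym p

  LabelOrdered⇒Oriented : ∀ o {y x} → LabelOrdered y x → Oriented (λ b c → LabelOrdered b c) o y x
  LabelOrdered⇒Oriented true  p = p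
  LabelOrdered⇒Oriented false p = LabelOrdered-sym p

  relabel : ∀ {y y′ x} → label y′ ≡ label y → LabelOrdered y x → LabelOrdered y′ x →
    E y′ x ≡ E y x × E x y′ ≡ E x y
  relabel {y} {y′} {x} same (_ , yx , xy) (_ , y′x , xy′) =
    trans y′x (trans (cong (λ l → <-tournament l (label x)) same) (sym yx)) ,
    trans xy′ (trans (cong (<-tournament (label x)) same) (sym xy))

  criterion : PairwiseCriterion labelExpansion AnyBase
  criterion = record
    { Good            = λ _ → LabelOrdered
    ; Good-irrefl     = λ (b≢b , _) → b≢b refl
    ; Good-weaken     = λ _ _ p → p
    ; Good-invariant  = invariant
    ; Good-stationary = λ o g _ _ _ _ p p′ →
                          relabel (autSE-label g _) (Oriented⇒LabelOrdered o p) (Oriented⇒LabelOrdered o p′)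
    }
    where
    invariant : ∀ (g : Aut SE) {A b c} → AnyBase A → LabelOrdered b c → LabelOrdered (g · b) (g · c)
    invariant g {b = b} {c} _ (b≢c , bc , cb) =
      (λ e → b≢c (·-injective g e)) ,
      trans (autSE-E g b c) (trans bc (sym (cong₂ <-tournament (autSE-label g b) (autSE-label g c)))) ,
      trans (autSE-E g c b) (trans cb (sym (cong₂ <-tournament (autSE-label g c) (autSE-label g b))))

  open PairwiseIndependence (fin m) E gen labelExpansion criterion
    using (Ind; isSWIR; symmetric; OnePointSteps; IndependentOf; IndependentOf-intro; IndependentOf-excludes)

  steps : OnePointSteps
  steps o {A} Y _ emb {b} b∉ =
    extension-by-w (IndependentOf-intro o λ y∈Y y∉A → LabelOrdered⇒Oriented o (ordered y∈Y y∉A))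
    where
    open LabelledStep Y (IndependentOf-excludes o) emb b∉
    ordered : ∀ {y} → y ∈ Y → y ∉ A → LabelOrdered w y
    ordered {y} y∈Y y∉A = by-part (y ~? b)
      where
      by-part : Dec (y ~ b) → LabelOrdered w y
      by-part (yes y~b) = w≢y , trans wy (sym (none same)) , trans yw (sym (none (sym same)))
        where
        w≢y = proj₁ (proj₁ (w-Y y∈Y y∉A) y~b)
        wy = proj₁ (proj₂ (proj₁ (w-Y y∈Y y∉A) y~b))
        yw = proj₂ (proj₂ (proj₁ (w-Y y∈Y y∉A) y~b))
        same : label w ≡ label y
        same = trans w-label (~⇒label≡ (~-sym y~b))
        none : ∀ {i j} → i ≡ j → <-tournament i j ≡ false
        none {i} refl = <-tournament-irrefl i
      by-part (no y≁b) =
        (λ w≡y → b≢y (trans (sym w-label) (cong label w≡y))) ,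
        trans wy (cong (λ l → <-tournament l (label y)) (sym w-label)) ,
        trans yw (trans (sym (<-tournament-flip b≢y)) (cong (<-tournament (label y)) (sym w-label)))
        where
        wy = proj₁ (proj₂ (w-Y y∈Y y∉A) y≁b)
        yw = proj₂ (proj₂ (w-Y y∈Y y∉A) y≁b)
        b≢y : label b ≢ label y
        b≢y same = y≁b (label≡⇒~ (sym same))

  hasFiniteSIRExpansion : HasFiniteSIRExpansion E
  hasFiniteSIRExpansion =
    unaryLanguage m , mkStr (unary m hasLabel) , SE-ultrahomogeneous , Ind , isSWIR steps , symmetric LabelOrdered-sym

proposition5p5 :
    (∀ (n : ℕ) → 2 < n → ∀ (E : ℕ → ℕ → Bool) → IsGenericPartiteTournament (fin n) E →
      ¬ HasLocalSWIR (graphStr E) × HasFiniteSIRExpansion E) ×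
    (∀ (E : ℕ → ℕ → Bool) → IsGenericPartiteTournament (fin 2) E →
      HasLocalSWIR (graphStr E) × ¬ HasSWIR (graphStr E)) ×
    (∀ (E : ℕ → ℕ → Bool) → IsGenericPartiteTournament ω E →
      HasSWIR (graphStr E))
proposition5p5 =
  finitelyManyParts ,
  (λ E gen → BipartiteLocalSWIR.hasLocalSWIR E gen , bipartite-noSWIR E gen) ,
  OmegaSWIR.hasSWIR
  where
  finitelyManyParts : ∀ n → 2 < n → ∀ E → IsGenericPartiteTournament (fin n) E →
    ¬ HasLocalSWIR (graphStr E) × HasFiniteSIRExpansion E
  finitelyManyParts (suc (suc (suc k))) _ E gen =
    noLocalSWIR k E gen , LabelledExpansion.hasFiniteSIRExpansion (suc (suc (suc k))) E gen
  finitelyManyParts 0 ()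
  finitelyManyParts 1 (s≤s ())
  finitelyManyParts 2 (s≤s (s≤s ()))
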